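{- Fix nonnegative integers $k,\ell$ and positive integers $1\leq m\leq n$. Then the number of $(k,\ell)$-pullback $(m,n)$-parking functions is \[ |\mathrm{PF}_{m,n}(k,\ell)|=\sum_{\pi\in \mathfrak{S}_{m,n}}\bigl|\{\alpha\in\mathrm{PF}_{m,n}(k,\ell):\mathcal{O}(\alpha)=\pi\}\bigr|=\sum_{\pi=\pi_1\pi_2\cdots\pi_n\in \mathfrak{S}_{m,n}}\left(\prod_{i=1}^n\bigl[\mathrm{B}(\pi_i)+\mathrm{F}(\pi_i)+1\bigr]\right), \] where, for $\pi_i>0$, $\mathrm{B}(\pi_i)=\min(\mathrm{Right}(\pi_i),k)$ and \[ \mathrm{F}(\pi_i)=\begin{cases}0 & \text{if } \mathrm{Left}(\pi_i)=0,\\ \min(i-1,\ell) & \text{if } 0<\mathrm{Left}(\pi_i)=i-1,\\ \max(\min(\mathrm{Left}(\pi_i)-k,\ell),0) & \text{if } 0<\mathrm{Left}(\pi_i)<i-1,\end{cases} \] and $\mathrm{B}(0)=\mathrm{F}(0)=0$ (so positions with $\pi_i=0$ contribute a factor $1$).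
   Context: $(k,\ell)$-pullback parking rule: given $\alpha=(a_1,\dots,a_m)\in[n]^m$, cars $1,2,\dots,m$ enter a one-way street with spots $1,\dots,n$ in this order. Car $j$ drives to spot $a_j$ and parks there if it is empty. Otherwise it checks spots $a_j-1,a_j-2,\dots,a_j-k$ in this order (stopping if it reaches the start of the street) and parks in the first empty one it encounters; if none is found, it checks spots $a_j+1,\dots,a_j+\ell$ in this order (not beyond spot $n$) and parks in the first empty one; if none is found, the car fails to park. $\alpha$ is a $(k,\ell)$-pullback $(m,n)$-parking function if all cars park; $\mathrm{PF}_{m,n}(k,\ell)$ denotes the set of these. $\mathfrak{S}_{m,n}$ is the set of words $\pi_1\cdots\pi_n$ that are permutations of the multiset consisting of $n-m$ zeros and the elements of $[m]$. The outcome $\mathcal{O}(\alpha)=\pi_1\cdots\pi_n\in\mathfrak{S}_{m,n}$ has $\pi_u=j$ if car $j$ parks in spot $u$ and $\pi_u=0$ if spot $u$ stays vacant. For $\pi\in\mathfrak{S}_{m,n}$ and $i$ with $\pi_i>0$: $\mathrm{Right}(\pi_i)$ is the largest $x\ge0$ such that $0<\pi_t<\pi_i$ for all $i+1\le t\le i+x$ (with $i+x\le n$); $\mathrm{Left}(\pi_i)$ is the largest $x\ge 0$ such that $0<\pi_t<\pi_i$ for all $i-x\le t\le i-1$ (with $i-x\ge 1$). -}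

module Defs where

open import Data.Nat using (ℕ; zero; suc; _+_; _*_; _∸_; _⊓_; _≡ᵇ_; _<ᵇ_)
open import Data.Bool using (Bool; true; false; _∧_; if_then_else_)
open import Data.List using (List; []; _∷_; _++_; map; concatMap; replicate;
  applyUpTo; length; filterᵇ; takeWhileᵇ; take; drop; reverse)
open import Data.Maybe using (Maybe; just; nothing)
open import Data.Nat.ListAction using (sum; product)

-- Conventions: spots and positions are 1-indexed natural numbers.
-- A street state / outcome word is a List ℕ of length n; entry 0 = vacant.

range1 : ℕ → List ℕ
range1 n = applyUpTo suc n

words : ℕ → List ℕ → List (List ℕ)
words zero    A = [] ∷ []
words (suc m) A = concatMap (λ a → map (a ∷_) (words m A)) A

-- 1-indexed lookup; out of range returns 1 (treated as "occupied", never used)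
at : List ℕ → ℕ → ℕ
at []       _             = 1
at (x ∷ xs) zero          = 1
at (x ∷ xs) (suc zero)    = x
at (x ∷ xs) (suc (suc i)) = at xs (suc i)

setAt : List ℕ → ℕ → ℕ → List ℕ
setAt []       _             v = []
setAt (x ∷ xs) zero          v = x ∷ xs
setAt (x ∷ xs) (suc zero)    v = v ∷ xs
setAt (x ∷ xs) (suc (suc i)) v = x ∷ setAt xs (suc i) v

candidates : ℕ → ℕ → ℕ → ℕ → List ℕ
candidates k ℓ n a =
  a ∷ (map (λ t → a ∸ t) (range1 (k ⊓ (a ∸ 1)))
       ++ map (λ t → a + t) (range1 (ℓ ⊓ (n ∸ a))))

firstEmpty : List ℕ → List ℕ → Maybe ℕ
firstEmpty st []       = nothing
firstEmpty st (u ∷ us) = if at st u ≡ᵇ 0 then just u else firstEmpty st us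

parkFrom : ℕ → ℕ → ℕ → ℕ → List ℕ → List ℕ → Maybe (List ℕ)
parkFrom k ℓ n j st []       = just st
parkFrom k ℓ n j st (a ∷ as) with firstEmpty st (candidates k ℓ n a)
... | nothing = nothing
... | just u  = parkFrom k ℓ n (suc j) (setAt st u j) as

outcome : ℕ → ℕ → ℕ → List ℕ → Maybe (List ℕ)
outcome k ℓ n α = parkFrom k ℓ n 1 (replicate n 0) α

isJust : {A : Set} → Maybe A → Bool
isJust (just _) = true
isJust nothing  = false

PF : ℕ → ℕ → ℕ → ℕ → List (List ℕ)
PF k ℓ m n = filterᵇ (λ α → isJust (outcome k ℓ n α)) (words m (range1 n))

eqList : List ℕ → List ℕ → Bool
eqList []       []       = true
eqList (x ∷ xs) (y ∷ ys) = (x ≡ᵇ y) ∧ eqList xs ys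
eqList _        _        = false

eqOutcome : Maybe (List ℕ) → List ℕ → Bool
eqOutcome nothing  π = false
eqOutcome (just w) π = eqList w π

fiber : ℕ → ℕ → ℕ → ℕ → List ℕ → List (List ℕ)
fiber k ℓ m n π = filterᵇ (λ α → eqOutcome (outcome k ℓ n α) π) (PF k ℓ m n)

countOcc : ℕ → List ℕ → ℕ
countOcc x w = length (filterᵇ (λ y → y ≡ᵇ x) w)

allB : (ℕ → Bool) → List ℕ → Bool
allB p []       = true
allB p (x ∷ xs) = p x ∧ allB p xs

-- 𝔖_{m,n}: words of length n over {0,…,m} in which each j ∈ [m] occurs exactly once
-- (hence 0 occurs exactly n-m times): permutations of the multiset {0^{n-m},1,…,m}
Smn : ℕ → ℕ → List (List ℕ)
Smn m n = filterᵇ (λ w → allB (λ j → countOcc j w ≡ᵇ 1) (range1 m))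
                  (words n (0 ∷ range1 m))

runBelow : ℕ → List ℕ → ℕ
runBelow p xs = length (takeWhileᵇ (λ v → (0 <ᵇ v) ∧ (v <ᵇ p)) xs)

Right : List ℕ → ℕ → ℕ
Right π i = runBelow (at π i) (drop i π)

Left : List ℕ → ℕ → ℕ
Left π i = runBelow (at π i) (reverse (take (i ∸ 1) π))

B : ℕ → List ℕ → ℕ → ℕ
B k π i = Right π i ⊓ k

-- max(min(L-k, ℓ), 0) over the integers equals (L ∸ k) ⊓ ℓ over ℕ
F : ℕ → ℕ → List ℕ → ℕ → ℕ
F k ℓ π i with Left π i
... | zero  = 0
... | suc L = if suc L ≡ᵇ (i ∸ 1) then (i ∸ 1) ⊓ ℓ else (suc L ∸ k) ⊓ ℓ

factor : ℕ → ℕ → List ℕ → ℕ → ℕ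
factor k ℓ π i = if at π i ≡ᵇ 0 then 1 else B k π i + F k ℓ π i + 1

weight : ℕ → ℕ → ℕ → List ℕ → ℕ
weight k ℓ n π = product (map (factor k ℓ π) (range1 n))

-- If α has outcome π, car j arrives to find exactly the cars of π smaller than j in place, so α
-- has outcome π iff every car j, facing that partial street, parks at the spot i holding j in π.
-- These conditions concern different cars independently, so the fibre of π is a product over cars
-- of the number of preferences sending car j to i. In that street spot i is vacant, followed by a
-- run of R = Right(π_i) occupied spots and preceded by a run of L = Left(π_i) of them, and a
-- preference a sends the car to i exactly when i − F(π_i) ≤ a ≤ i + min(R, k): from the right it
-- must pass the run backwards within k steps, from the left it must come forwards within ℓ steps
-- after a backward search that stays inside the left run. That gives B + F + 1 preferences. As
-- every outcome lies in 𝔖_{m,n}, summing the fibres over 𝔖_{m,n} counts PF_{m,n}(k, ℓ).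
{-# OPTIONS --safe #-}
module Submission where

open import Defs
open import Data.Bool using (Bool; true; false; _∧_; if_then_else_; T; T?)
open import Data.Bool.Properties using (T-≡; T-∧; ∧-zeroʳ)
open import Data.Empty using (⊥-elim)
open import Data.List using (List; []; _∷_; _++_; map; concatMap; replicate; applyUpTo; length; filterᵇ; takeWhileᵇ; take; drop; reverse)
open import Data.List.Properties using (filter-++; filter-all; filter-none; length-++; length-map; length-applyUpTo; length-replicate; length-drop; length-take; length-reverse; map-applyUpTo; map-cong-local; unfold-reverse; ++-identityʳ)
open import Data.List.Relation.Unary.All as All using (All; []; _∷_)
open import Data.List.Relation.Unary.All.Properties using (concat⁺; map⁺; all-filter; filter⁺; applyUpTo⁺₁; applyUpTo⁻)
open import Data.Maybe using (Maybe; just; nothing)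
open import Data.Maybe.Properties using (just-injective)
open import Data.Nat using (ℕ; zero; suc; _+_; _*_; _∸_; _⊓_; _≡ᵇ_; _<ᵇ_; _≤ᵇ_; _≤_; _<_; z≤n; s≤s; s≤s⁻¹; z<s; _≤?_)
open import Data.Nat.ListAction using (sum; product)
open import Data.Nat.Properties
open import Algebra.Properties.CommutativeSemigroup +-commutativeSemigroup using (interchange)
open import Data.Nat.Tactic.RingSolver using (solve-∀)
open import Data.Product using (_×_; _,_; proj₁; proj₂; Σ)
open import Data.Sum using (_⊎_; inj₁; inj₂)
open import Data.Unit using (⊤; tt)
open import Function using (_∘_; Equivalence)
open import Relation.Binary.Definitions using (tri<; tri≈; tri>)
open import Relation.Binary.PropositionalEquality
open import Relation.Nullary using (¬_; yes; no)

T⇒≡true : ∀ {b} → T b → b ≡ true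
T⇒≡true = Equivalence.to T-≡

≡true⇒T : ∀ {b} → b ≡ true → T b
≡true⇒T = Equivalence.from T-≡

¬T⇒≡false : ∀ {b} → ¬ T b → b ≡ false
¬T⇒≡false {false} _  = refl
¬T⇒≡false {true}  ¬t = ⊥-elim (¬t tt)

≡false⇒¬T : ∀ {b} → b ≡ false → ¬ T b
≡false⇒¬T refl ()

≡ᵇ≡true⇒≡ : ∀ x y → (x ≡ᵇ y) ≡ true → x ≡ y
≡ᵇ≡true⇒≡ x y = ≡ᵇ⇒≡ x y ∘ ≡true⇒T

≡ᵇ≡false⇒≢ : ∀ x y → (x ≡ᵇ y) ≡ false → x ≢ y
≡ᵇ≡false⇒≢ x y e = ≡false⇒¬T e ∘ ≡⇒≡ᵇ x y

≡ᵇ-refl : ∀ x → (x ≡ᵇ x) ≡ true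
≡ᵇ-refl x = T⇒≡true (≡⇒≡ᵇ x x refl)

≢⇒≡ᵇ≡false : ∀ x y → x ≢ y → (x ≡ᵇ y) ≡ false
≢⇒≡ᵇ≡false x y x≢y = ¬T⇒≡false (x≢y ∘ ≡ᵇ⇒≡ x y)

<ᵇ≡true⇒< : ∀ x y → (x <ᵇ y) ≡ true → x < y
<ᵇ≡true⇒< x y = <ᵇ⇒< x y ∘ ≡true⇒T

<ᵇ≡false⇒≮ : ∀ x y → (x <ᵇ y) ≡ false → ¬ (x < y)
<ᵇ≡false⇒≮ x y e = ≡false⇒¬T e ∘ <⇒<ᵇ

<⇒<ᵇ≡true : ∀ {x y} → x < y → (x <ᵇ y) ≡ true
<⇒<ᵇ≡true = T⇒≡true ∘ <⇒<ᵇ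

≮⇒<ᵇ≡false : ∀ x y → ¬ (x < y) → (x <ᵇ y) ≡ false
≮⇒<ᵇ≡false x y x≮y = ¬T⇒≡false (x≮y ∘ <ᵇ⇒< x y)

≤⇒≤ᵇ≡true : ∀ {x y} → x ≤ y → (x ≤ᵇ y) ≡ true
≤⇒≤ᵇ≡true = T⇒≡true ∘ ≤⇒≤ᵇ

≰⇒≤ᵇ≡false : ∀ x y → ¬ (x ≤ y) → (x ≤ᵇ y) ≡ false
≰⇒≤ᵇ≡false x y x≰y = ¬T⇒≡false (x≰y ∘ ≤ᵇ⇒≤ x y)

∧≡true⇒ˡ : ∀ a b → (a ∧ b) ≡ true → a ≡ true
∧≡true⇒ˡ true b _ = refl

∧≡true⇒ʳ : ∀ a b → (a ∧ b) ≡ true → b ≡ true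
∧≡true⇒ʳ true b e = e

module _ {A : Set} where

  length-filterᵇ-∷ : (p : A → Bool) (x : A) (xs : List A) →
    length (filterᵇ p (x ∷ xs)) ≡ (if p x then 1 else 0) + length (filterᵇ p xs)
  length-filterᵇ-∷ p x xs with p x
  ... | true  = refl
  ... | false = refl

  filterᵇ-filterᵇ-⇒ : (p q : A → Bool) (xs : List A) → (∀ x → p x ≡ true → q x ≡ true) →
    filterᵇ p (filterᵇ q xs) ≡ filterᵇ p xs
  filterᵇ-filterᵇ-⇒ p q [] p⇒q = refl
  filterᵇ-filterᵇ-⇒ p q (x ∷ xs) p⇒q with q x in qx
  ... | true with p x
  ...   | true  = cong (x ∷_) (filterᵇ-filterᵇ-⇒ p q xs p⇒q)
  ...   | false = filterᵇ-filterᵇ-⇒ p q xs p⇒q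
  filterᵇ-filterᵇ-⇒ p q (x ∷ xs) p⇒q | false with p x in px
  ...   | true  with () ← trans (sym (p⇒q x px)) qx
  ...   | false = filterᵇ-filterᵇ-⇒ p q xs p⇒q

  filterᵇ-cong-local : (p q : A → Bool) (xs : List A) → All (λ x → p x ≡ q x) xs →
    filterᵇ p xs ≡ filterᵇ q xs
  filterᵇ-cong-local p q [] [] = refl
  filterᵇ-cong-local p q (x ∷ xs) (e ∷ es) with p x | q x
  filterᵇ-cong-local p q (x ∷ xs) (refl ∷ es) | true  | .true  = cong (x ∷_) (filterᵇ-cong-local p q xs es)
  filterᵇ-cong-local p q (x ∷ xs) (refl ∷ es) | false | .false = filterᵇ-cong-local p q xs es

  All-filterᵇ : (p : A → Bool) {Q : A → Set} {xs : List A} → All Q xs →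
    All (λ x → p x ≡ true × Q x) (filterᵇ p xs)
  All-filterᵇ p {xs = xs} qs =
    All.map (λ (t , q) → T⇒≡true t , q) (All.zip (all-filter (T? ∘ p) xs , filter⁺ (T? ∘ p) qs))

  length-filterᵇ-++ : (p : A → Bool) (xs ys : List A) →
    length (filterᵇ p (xs ++ ys)) ≡ length (filterᵇ p xs) + length (filterᵇ p ys)
  length-filterᵇ-++ p xs ys = trans (cong length (filter-++ (T? ∘ p) xs ys)) (length-++ (filterᵇ p xs))

  length-filterᵇ-applyUpTo-all : (p : A → Bool) (h : ℕ → A) (n : ℕ) →
    (∀ {t} → t < n → T (p (h t))) → length (filterᵇ p (applyUpTo h n)) ≡ n
  length-filterᵇ-applyUpTo-all p h n all =
    trans (cong length (filter-all (T? ∘ p) (applyUpTo⁺₁ h n all))) (length-applyUpTo h n)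

  length-filterᵇ-applyUpTo-none : (p : A → Bool) (h : ℕ → A) (n : ℕ) →
    (∀ {t} → t < n → ¬ T (p (h t))) → length (filterᵇ p (applyUpTo h n)) ≡ 0
  length-filterᵇ-applyUpTo-none p h n none = cong length (filter-none (T? ∘ p) (applyUpTo⁺₁ h n none))

  applyUpTo-cong-< : (f g : ℕ → A) (n : ℕ) → (∀ t → t < n → f t ≡ g t) → applyUpTo f n ≡ applyUpTo g n
  applyUpTo-cong-< f g zero    f≡g = refl
  applyUpTo-cong-< f g (suc n) f≡g =
    cong₂ _∷_ (f≡g 0 z<s) (applyUpTo-cong-< (f ∘ suc) (g ∘ suc) n (λ t t<n → f≡g (suc t) (s≤s t<n)))

  applyUpTo-+ : (f : ℕ → A) (a b : ℕ) → applyUpTo f (a + b) ≡ applyUpTo f a ++ applyUpTo (λ t → f (a + t)) b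
  applyUpTo-+ f zero    b = refl
  applyUpTo-+ f (suc a) b = cong (f 0 ∷_) (applyUpTo-+ (f ∘ suc) a b)

  sum-map-+ : (f g : A → ℕ) (xs : List A) → sum (map (λ x → f x + g x) xs) ≡ sum (map f xs) + sum (map g xs)
  sum-map-+ f g []       = refl
  sum-map-+ f g (x ∷ xs) = trans (cong (f x + g x +_) (sum-map-+ f g xs)) (interchange (f x) (g x) _ _)

  sum-map-0 : (xs : List A) → sum (map (λ _ → 0) xs) ≡ 0
  sum-map-0 []       = refl
  sum-map-0 (x ∷ xs) = sum-map-0 xs

  sum-indicator : (q : A → Bool) (xs : List A) → sum (map (λ s → if q s then 1 else 0) xs) ≡ length (filterᵇ q xs)
  sum-indicator q []       = refl
  sum-indicator q (x ∷ xs) with q x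
  ... | true  = cong suc (sum-indicator q xs)
  ... | false = sum-indicator q xs

length≡sum-length-filterᵇ : {X S : Set} (q : S → X → Bool) (xs : List X) (ss : List S) →
  All (λ x → length (filterᵇ (λ s → q s x) ss) ≡ 1) xs →
  length xs ≡ sum (map (λ s → length (filterᵇ (q s) xs)) ss)
length≡sum-length-filterᵇ q []       ss []         = sym (sum-map-0 ss)
length≡sum-length-filterᵇ q (x ∷ xs) ss (c ∷ cs) = sym (begin
  sum (map (λ s → length (filterᵇ (q s) (x ∷ xs))) ss)
    ≡⟨ cong sum (map-cong-local (All.universal (λ s → length-filterᵇ-∷ (q s) x xs) ss)) ⟩
  sum (map (λ s → (if q s x then 1 else 0) + length (filterᵇ (q s) xs)) ss)
    ≡⟨ sum-map-+ (λ s → if q s x then 1 else 0) (λ s → length (filterᵇ (q s) xs)) ss ⟩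
  sum (map (λ s → if q s x then 1 else 0) ss) + sum (map (λ s → length (filterᵇ (q s) xs)) ss)
    ≡⟨ cong₂ _+_ (trans (sum-indicator (λ s → q s x) ss) c) (sym (length≡sum-length-filterᵇ q xs ss cs)) ⟩
  suc (length xs) ∎)
  where open ≡-Reasoning

length-setAt : ∀ st u v → length (setAt st u v) ≡ length st
length-setAt []       u             v = refl
length-setAt (x ∷ st) zero          v = refl
length-setAt (x ∷ st) (suc zero)    v = refl
length-setAt (x ∷ st) (suc (suc u)) v = cong suc (length-setAt st (suc u) v)

at-setAt-≡ : ∀ st u v → at st u ≡ 0 → at (setAt st u v) u ≡ v
at-setAt-≡ (x ∷ st) (suc zero)    v e = refl
at-setAt-≡ (x ∷ st) (suc (suc u)) v e = at-setAt-≡ st (suc u) v e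

at-setAt-≢ : ∀ st w u v → w ≢ u → at (setAt st w v) u ≡ at st u
at-setAt-≢ []       w             u             v w≢u = refl
at-setAt-≢ (x ∷ st) zero          u             v w≢u = refl
at-setAt-≢ (x ∷ st) (suc zero)    zero          v w≢u = refl
at-setAt-≢ (x ∷ st) (suc zero)    (suc zero)    v w≢u = ⊥-elim (w≢u refl)
at-setAt-≢ (x ∷ st) (suc zero)    (suc (suc u)) v w≢u = refl
at-setAt-≢ (x ∷ st) (suc (suc w)) zero          v w≢u = refl
at-setAt-≢ (x ∷ st) (suc (suc w)) (suc zero)    v w≢u = refl
at-setAt-≢ (x ∷ st) (suc (suc w)) (suc (suc u)) v w≢u = at-setAt-≢ st (suc w) (suc u) v (w≢u ∘ cong suc)

All-setAt : ∀ {P : ℕ → Set} st u v → All P st → P v → All P (setAt st u v)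
All-setAt []       u             v []       pv = []
All-setAt (x ∷ st) zero          v ps       pv = ps
All-setAt (x ∷ st) (suc zero)    v (p ∷ ps) pv = pv ∷ ps
All-setAt (x ∷ st) (suc (suc u)) v (p ∷ ps) pv = p ∷ All-setAt st (suc u) v ps pv

vacant⇒inRange : ∀ st u → at st u ≡ 0 → 1 ≤ u × u ≤ length st
vacant⇒inRange (x ∷ st) (suc zero)    e = s≤s z≤n , s≤s z≤n
vacant⇒inRange (x ∷ st) (suc (suc u)) e = s≤s z≤n , s≤s (proj₂ (vacant⇒inRange st (suc u) e))

at-map : ∀ (f : ℕ → ℕ) xs p → 1 ≤ p → p ≤ length xs → at (map f xs) p ≡ f (at xs p)
at-map f (x ∷ xs) (suc zero)    _ _         = refl
at-map f (x ∷ xs) (suc (suc p)) _ (s≤s p≤) = at-map f xs (suc p) (s≤s z≤n) p≤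

at-All : ∀ {P : ℕ → Set} xs p → All P xs → 1 ≤ p → p ≤ length xs → P (at xs p)
at-All (x ∷ xs) (suc zero)    (px ∷ _)  _ _         = px
at-All (x ∷ xs) (suc (suc p)) (_ ∷ pxs) _ (s≤s p≤) = at-All xs (suc p) pxs (s≤s z≤n) p≤

at-drop : ∀ i (xs : List ℕ) s → at (drop i xs) (suc s) ≡ at xs (suc (i + s))
at-drop zero    xs       s = refl
at-drop (suc i) []       s = refl
at-drop (suc i) (x ∷ xs) s = at-drop i xs s

at-take : ∀ c (xs : List ℕ) q → q ≤ c → at (take c xs) q ≡ at xs q
at-take zero    []       q             _         = refl
at-take (suc c) []       q             _         = refl
at-take zero    (x ∷ xs) zero          _         = refl
at-take (suc c) (x ∷ xs) zero          _         = refl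
at-take (suc c) (x ∷ xs) (suc zero)    _         = refl
at-take (suc c) (x ∷ xs) (suc (suc q)) (s≤s q≤) = at-take c xs (suc q) q≤

at-++ˡ : ∀ (ys zs : List ℕ) s → s < length ys → at (ys ++ zs) (suc s) ≡ at ys (suc s)
at-++ˡ (y ∷ ys)      zs zero    _         = refl
at-++ˡ (y ∷ y′ ∷ ys) zs (suc s) (s≤s s<) = at-++ˡ (y′ ∷ ys) zs s s<

at-++-length : ∀ (ys : List ℕ) x zs → at (ys ++ x ∷ zs) (suc (length ys)) ≡ x
at-++-length []            x zs = refl
at-++-length (y ∷ [])      x zs = refl
at-++-length (y ∷ y′ ∷ ys) x zs = at-++-length (y′ ∷ ys) x zs

at-reverse : ∀ (xs : List ℕ) s q → s + q ≡ length xs → 1 ≤ q → at (reverse xs) (suc s) ≡ at xs q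
at-reverse [] s q e q≥1 = ⊥-elim (<-irrefl refl (≤-trans q≥1 (≤-trans (m≤n+m q s) (≤-reflexive e))))
at-reverse (x ∷ xs) s (suc zero) e _ rewrite unfold-reverse x xs =
  trans (cong (λ z → at (reverse xs ++ x ∷ []) (suc z)) s≡length)
        (at-++-length (reverse xs) x [])
  where
  s≡length : s ≡ length (reverse xs)
  s≡length = trans (suc-injective (trans (cong suc (sym (+-identityʳ s))) (trans (sym (+-suc s 0)) e)))
                   (sym (length-reverse xs))
at-reverse (x ∷ xs) s (suc (suc q)) e _ rewrite unfold-reverse x xs =
  trans (at-++ˡ (reverse xs) (x ∷ []) s (subst (s <_) (sym (length-reverse xs)) s<))
        (at-reverse xs s (suc q) e′ (s≤s z≤n))
  where
  e′ : s + suc q ≡ length xs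
  e′ = suc-injective (trans (sym (+-suc s (suc q))) e)
  s< : s < length xs
  s< = subst (s <_) e′ (m<m+n s (s≤s z≤n))

takeWhileᵇ-all : ∀ (p : ℕ → Bool) xs s → s < length (takeWhileᵇ p xs) → p (at xs (suc s)) ≡ true
takeWhileᵇ-all p (x ∷ xs) s s< with p x in px
takeWhileᵇ-all p (x ∷ xs) zero    s<        | true = px
takeWhileᵇ-all p (x ∷ xs) (suc s) (s≤s s<) | true with xs
... | y ∷ ys = takeWhileᵇ-all p (y ∷ ys) s s<

takeWhileᵇ-stop : ∀ (p : ℕ → Bool) xs → length (takeWhileᵇ p xs) < length xs →
  p (at xs (suc (length (takeWhileᵇ p xs)))) ≡ false
takeWhileᵇ-stop p (x ∷ xs) < with p x in px
... | false = px
... | true with xs | <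
...   | y ∷ ys | s≤s <′ = takeWhileᵇ-stop p (y ∷ ys) <′

length-takeWhileᵇ≤ : ∀ (p : ℕ → Bool) xs → length (takeWhileᵇ p xs) ≤ length xs
length-takeWhileᵇ≤ p []       = z≤n
length-takeWhileᵇ≤ p (x ∷ xs) with p x
... | true  = s≤s (length-takeWhileᵇ≤ p xs)
... | false = z≤n

countOcc-∷ : ∀ c x w → countOcc c (x ∷ w) ≡ (if x ≡ᵇ c then 1 else 0) + countOcc c w
countOcc-∷ c x w = length-filterᵇ-∷ (λ y → y ≡ᵇ c) x w

countOcc-setAt : ∀ c st u v → c ≢ 0 → at st u ≡ 0 →
  countOcc c (setAt st u v) ≡ (if v ≡ᵇ c then 1 else 0) + countOcc c st
countOcc-setAt c (x ∷ st) (suc zero) v c≢0 refl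
  rewrite countOcc-∷ c v st | countOcc-∷ c 0 st | ≢⇒≡ᵇ≡false 0 c (c≢0 ∘ sym) = refl
countOcc-setAt c (x ∷ st) (suc (suc u)) v c≢0 e
  rewrite countOcc-∷ c x (setAt st (suc u) v) | countOcc-∷ c x st | countOcc-setAt c st (suc u) v c≢0 e =
  +-comm-middle (if x ≡ᵇ c then 1 else 0) (if v ≡ᵇ c then 1 else 0) (countOcc c st)
  where
  +-comm-middle : ∀ a b c → a + (b + c) ≡ b + (a + c)
  +-comm-middle a b c = trans (sym (+-assoc a b c)) (trans (cong (_+ c) (+-comm a b)) (+-assoc b a c))

countOcc-All< : ∀ j st → All (_< j) st → countOcc j st ≡ 0
countOcc-All< j []       []         = refl
countOcc-All< j (x ∷ st) (x<j ∷ ps) rewrite countOcc-∷ j x st | ≢⇒≡ᵇ≡false x j (λ e → <-irrefl e x<j) =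
  countOcc-All< j st ps

countOcc-pos : ∀ π u c → at π u ≡ c → 1 ≤ u → u ≤ length π → 1 ≤ countOcc c π
countOcc-pos (x ∷ π) (suc zero) c refl _ _ rewrite countOcc-∷ x x π | ≡ᵇ-refl x = s≤s z≤n
countOcc-pos (x ∷ π) (suc (suc u)) c e _ (s≤s u≤) rewrite countOcc-∷ c x π =
  ≤-trans (countOcc-pos π (suc u) c e (s≤s z≤n) u≤) (m≤n+m _ _)

countOcc≡1⇒position-unique : ∀ π c u v → countOcc c π ≡ 1 → at π u ≡ c → at π v ≡ c →
  1 ≤ u → u ≤ length π → 1 ≤ v → v ≤ length π → u ≡ v
countOcc≡1⇒position-unique (x ∷ π) c (suc zero) (suc zero) _ _ _ _ _ _ _ = refl
countOcc≡1⇒position-unique (x ∷ π) c (suc zero) (suc (suc v)) once refl ev _ _ _ (s≤s v≤)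
  rewrite countOcc-∷ x x π | ≡ᵇ-refl x =
  ⊥-elim (<-irrefl (sym (suc-injective once)) (countOcc-pos π (suc v) x ev (s≤s z≤n) v≤))
countOcc≡1⇒position-unique (x ∷ π) c (suc (suc u)) (suc zero) once eu refl _ (s≤s u≤) _ _
  rewrite countOcc-∷ x x π | ≡ᵇ-refl x =
  ⊥-elim (<-irrefl (sym (suc-injective once)) (countOcc-pos π (suc u) x eu (s≤s z≤n) u≤))
countOcc≡1⇒position-unique (x ∷ π) c (suc (suc u)) (suc (suc v)) once eu ev _ (s≤s u≤) _ (s≤s v≤)
  with x ≡ᵇ c
... | true  = ⊥-elim (<-irrefl (sym (suc-injective once)) (countOcc-pos π (suc u) c eu (s≤s z≤n) u≤))
... | false = cong suc (countOcc≡1⇒position-unique π c (suc u) (suc v) once eu ev (s≤s z≤n) u≤ (s≤s z≤n) v≤)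

firstEmpty-vacant : ∀ st xs u → firstEmpty st xs ≡ just u → at st u ≡ 0
firstEmpty-vacant st (x ∷ xs) u e with at st x ≡ᵇ 0 in vacant
firstEmpty-vacant st (x ∷ xs) u refl | true = ≡ᵇ≡true⇒≡ _ _ vacant
... | false = firstEmpty-vacant st xs u e

firstEmpty-∷-occupied : ∀ st x ys → at st x ≢ 0 → firstEmpty st (x ∷ ys) ≡ firstEmpty st ys
firstEmpty-∷-occupied st x ys occupied rewrite ≢⇒≡ᵇ≡false (at st x) 0 occupied = refl

firstEmpty-∷-vacant : ∀ st x ys → at st x ≡ 0 → firstEmpty st (x ∷ ys) ≡ just x
firstEmpty-∷-vacant st x ys vacant rewrite vacant = refl

firstEmpty-∷-just : ∀ st a rest u → firstEmpty st (a ∷ rest) ≡ just u → a ≢ u →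
  at st a ≢ 0 × firstEmpty st rest ≡ just u
firstEmpty-∷-just st a rest u e a≢u = occupied , trans (sym (firstEmpty-∷-occupied st a rest occupied)) e
  where
  occupied : at st a ≢ 0
  occupied vacant = a≢u (just-injective (trans (sym (firstEmpty-∷-vacant st a rest vacant)) e))

firstEmpty-skip : ∀ st h K ys → (∀ t → t < K → at st (h t) ≢ 0) →
  firstEmpty st (applyUpTo h K ++ ys) ≡ firstEmpty st ys
firstEmpty-skip st h zero    ys occ = refl
firstEmpty-skip st h (suc K) ys occ =
  trans (firstEmpty-∷-occupied st (h 0) (applyUpTo (h ∘ suc) K ++ ys) (occ 0 z<s))
        (firstEmpty-skip st (h ∘ suc) K ys (λ t t< → occ (suc t) (s≤s t<)))

firstEmpty-hit : ∀ st h K ys r → r < K → (∀ t → t < r → at st (h t) ≢ 0) → at st (h r) ≡ 0 →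
  firstEmpty st (applyUpTo h K ++ ys) ≡ just (h r)
firstEmpty-hit st h (suc K) ys zero    _         occ vacant =
  firstEmpty-∷-vacant st (h 0) (applyUpTo (h ∘ suc) K ++ ys) vacant
firstEmpty-hit st h (suc K) ys (suc r) (s≤s r<) occ vacant =
  trans (firstEmpty-∷-occupied st (h 0) (applyUpTo (h ∘ suc) K ++ ys) (occ 0 z<s))
        (firstEmpty-hit st (h ∘ suc) K ys r r< (λ t t< → occ (suc t) (s≤s t<)) vacant)

firstEmpty-applyUpTo-hit : ∀ st h K r → r < K → (∀ t → t < r → at st (h t) ≢ 0) → at st (h r) ≡ 0 →
  firstEmpty st (applyUpTo h K) ≡ just (h r)
firstEmpty-applyUpTo-hit st h K r r<K occ vacant =
  trans (cong (firstEmpty st) (sym (++-identityʳ (applyUpTo h K)))) (firstEmpty-hit st h K [] r r<K occ vacant)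

FoundAt : List ℕ → (ℕ → ℕ) → ℕ → ℕ → Set
FoundAt st h K u = Σ ℕ λ r → r < K × u ≡ h r × (∀ t → t < r → at st (h t) ≢ 0)

firstEmpty-++-inv : ∀ st h K ys u → firstEmpty st (applyUpTo h K ++ ys) ≡ just u →
  FoundAt st h K u ⊎ ((∀ t → t < K → at st (h t) ≢ 0) × firstEmpty st ys ≡ just u)
firstEmpty-++-inv st h zero ys u e = inj₂ ((λ t ()) , e)
firstEmpty-++-inv st h (suc K) ys u e with at st (h 0) ≡ᵇ 0 in h0
... | true = inj₁ (0 , z<s , just-injective (sym e) , λ t ())
... | false with firstEmpty-++-inv st (h ∘ suc) K ys u e
...   | inj₁ (r , r<K , u≡ , occ) = inj₁ (suc r , s≤s r<K , u≡ , λ { zero _ → ≡ᵇ≡false⇒≢ _ _ h0 ; (suc t) (s≤s t<) → occ t t< })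
...   | inj₂ (occ , e′)          = inj₂ ((λ { zero _ → ≡ᵇ≡false⇒≢ _ _ h0 ; (suc t) (s≤s t<) → occ t t< }) , e′)

firstEmpty-applyUpTo-inv : ∀ st h K u → firstEmpty st (applyUpTo h K) ≡ just u → FoundAt st h K u
firstEmpty-applyUpTo-inv st h K u e
  with firstEmpty-++-inv st h K [] u (trans (cong (firstEmpty st) (++-identityʳ (applyUpTo h K))) e)
... | inj₁ found = found

-- Outcomes lie in 𝔖_{m,n}

-- Arranges n (suc m) w says w ∈ 𝔖_{m,n}.
record Arranges (n j : ℕ) (w : List ℕ) : Set where
  field
    length≡ : length w ≡ n
    bounded : All (_< j) w
    once    : ∀ c → 1 ≤ c → c < j → countOcc c w ≡ 1
open Arranges

Arranges-empty : ∀ n → Arranges n 1 (replicate n 0)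
Arranges-empty n = record
  { length≡ = length-replicate n
  ; bounded = zeros<1 n
  ; once    = λ c 1≤c c<1 → ⊥-elim (<-irrefl refl (≤-trans c<1 1≤c))
  }
  where
  zeros<1 : ∀ n → All (_< 1) (replicate n 0)
  zeros<1 zero    = []
  zeros<1 (suc n) = z<s ∷ zeros<1 n

Arranges-setAt : ∀ n j st u → 1 ≤ j → Arranges n j st → at st u ≡ 0 → Arranges n (suc j) (setAt st u j)
Arranges-setAt n j st u 1≤j A vacant = record
  { length≡ = trans (length-setAt st u j) (length≡ A)
  ; bounded = All-setAt st u j (All.map m≤n⇒m≤1+n (bounded A)) ≤-refl
  ; once    = once′
  }
  where
  once′ : ∀ c → 1 ≤ c → c < suc j → countOcc c (setAt st u j) ≡ 1
  once′ c 1≤c c<1+j rewrite countOcc-setAt c st u j (λ c≡0 → <-irrefl (sym c≡0) 1≤c) vacant with j ≡ᵇ c in j≟c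
  ... | true rewrite sym (≡ᵇ≡true⇒≡ j c j≟c) = cong suc (countOcc-All< j st (bounded A))
  ... | false = once A c 1≤c (≤∧≢⇒< (s≤s⁻¹ c<1+j) (≡ᵇ≡false⇒≢ j c j≟c ∘ sym))

parkFrom-Arranges : ∀ k ℓ n j st as w → 1 ≤ j → Arranges n j st →
  parkFrom k ℓ n j st as ≡ just w → Arranges n (j + length as) w
parkFrom-Arranges k ℓ n j st [] w _ A refl rewrite +-identityʳ j = A
parkFrom-Arranges k ℓ n j st (a ∷ as) w 1≤j A e with firstEmpty st (candidates k ℓ n a) in found
... | just u rewrite +-suc j (length as) =
  parkFrom-Arranges k ℓ n (suc j) (setAt st u j) as w (s≤s z≤n)
    (Arranges-setAt n j st u 1≤j A (firstEmpty-vacant st (candidates k ℓ n a) u found)) e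

outcome-Arranges : ∀ k ℓ m n α w → length α ≡ m → outcome k ℓ n α ≡ just w → Arranges n (suc m) w
outcome-Arranges k ℓ m n α w refl = parkFrom-Arranges k ℓ n 1 (replicate n 0) α w (s≤s z≤n) (Arranges-empty n)

allB≡true⇒All : (p : ℕ → Bool) (xs : List ℕ) → allB p xs ≡ true → All (λ x → p x ≡ true) xs
allB≡true⇒All p []       _ = []
allB≡true⇒All p (x ∷ xs) e = ∧≡true⇒ˡ (p x) _ e ∷ allB≡true⇒All p xs (∧≡true⇒ʳ (p x) _ e)

All⇒allB≡true : (p : ℕ → Bool) {xs : List ℕ} → All (λ x → p x ≡ true) xs → allB p xs ≡ true
All⇒allB≡true p []         = refl
All⇒allB≡true p (px ∷ pxs) rewrite px = All⇒allB≡true p pxs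

eqList⇒≡ : ∀ w s → eqList w s ≡ true → w ≡ s
eqList⇒≡ []      []      e = refl
eqList⇒≡ (x ∷ w) (y ∷ s) e = cong₂ _∷_ (≡ᵇ≡true⇒≡ x y (∧≡true⇒ˡ _ _ e)) (eqList⇒≡ w s (∧≡true⇒ʳ (x ≡ᵇ y) _ e))

eqList-refl : ∀ w → eqList w w ≡ true
eqList-refl []      = refl
eqList-refl (x ∷ w) rewrite ≡ᵇ-refl x = eqList-refl w

All-words : ∀ {P : ℕ → Set} n A → All P A → All (λ w → length w ≡ n × All P w) (words n A)
All-words zero    A pA = (refl , []) ∷ []
All-words {P} (suc n) A pA = concat⁺ (map⁺ (All.map extend pA))
  where
  extend : ∀ {a} → P a → All (λ w → length w ≡ suc n × All P w) (map (a ∷_) (words n A))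
  extend pa = map⁺ (All.map (λ (len , pw) → cong suc len , pa ∷ pw) (All-words n A pA))

length-filterᵇ-map-∷ : (P : ℕ → Bool) (Q p : List ℕ → Bool) (a : ℕ) (W : List (List ℕ)) →
  (∀ s → p (a ∷ s) ≡ (P a ∧ Q s)) →
  length (filterᵇ p (map (a ∷_) W)) ≡ (if P a then length (filterᵇ Q W) else 0)
length-filterᵇ-map-∷ P Q p a [] p≡ with P a
... | true  = refl
... | false = refl
length-filterᵇ-map-∷ P Q p a (s ∷ W) p≡
  rewrite length-filterᵇ-∷ p (a ∷ s) (map (a ∷_) W) | p≡ s | length-filterᵇ-map-∷ P Q p a W p≡ with P a
... | true  = sym (length-filterᵇ-∷ Q s W)
... | false = refl

length-filterᵇ-words-∷ : (P : ℕ → Bool) (Q p : List ℕ → Bool) (W : List (List ℕ)) (A : List ℕ) →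
  (∀ a s → p (a ∷ s) ≡ (P a ∧ Q s)) →
  length (filterᵇ p (concatMap (λ a → map (a ∷_) W) A)) ≡ length (filterᵇ P A) * length (filterᵇ Q W)
length-filterᵇ-words-∷ P Q p W [] p≡ = refl
length-filterᵇ-words-∷ P Q p W (a ∷ A) p≡
  rewrite length-filterᵇ-++ p (map (a ∷_) W) (concatMap (λ a → map (a ∷_) W) A)
        | length-filterᵇ-map-∷ P Q p a W (p≡ a) | length-filterᵇ-words-∷ P Q p W A p≡
  with P a
... | true  = refl
... | false = refl

words-unique : ∀ w A → All (λ x → length (filterᵇ (x ≡ᵇ_) A) ≡ 1) w →
  length (filterᵇ (eqList w) (words (length w) A)) ≡ 1
words-unique []      A []       = refl
words-unique (x ∷ w) A (c ∷ cs)
  rewrite length-filterᵇ-words-∷ (x ≡ᵇ_) (eqList w) (eqList (x ∷ w)) (words (length w) A) A (λ a s → refl)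
        | c | words-unique w A cs = refl

0∷range1-unique : ∀ m x → x < suc m → length (filterᵇ (x ≡ᵇ_) (0 ∷ range1 m)) ≡ 1
0∷range1-unique m zero _ = cong suc (length-filterᵇ-applyUpTo-none (0 ≡ᵇ_) suc m (λ _ ()))
0∷range1-unique m (suc x) (s≤s x<m) with m ∸ suc x | m+[n∸m]≡n x<m
... | r | refl = begin
  length (filterᵇ (suc x ≡ᵇ_) (applyUpTo suc (suc x + r)))
    ≡⟨ cong (length ∘ filterᵇ (suc x ≡ᵇ_) ∘ applyUpTo suc) (sym (+-suc x r)) ⟩
  length (filterᵇ (suc x ≡ᵇ_) (applyUpTo suc (x + suc r)))
    ≡⟨ cong (length ∘ filterᵇ (suc x ≡ᵇ_)) (applyUpTo-+ suc x (suc r)) ⟩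
  length (filterᵇ (suc x ≡ᵇ_) (applyUpTo suc x ++ suc (x + 0) ∷ applyUpTo (λ t → suc (x + suc t)) r))
    ≡⟨ length-filterᵇ-++ (suc x ≡ᵇ_) (applyUpTo suc x) _ ⟩
  length (filterᵇ (suc x ≡ᵇ_) (applyUpTo suc x)) + length (filterᵇ (suc x ≡ᵇ_) (suc (x + 0) ∷ applyUpTo (λ t → suc (x + suc t)) r))
    ≡⟨ cong₂ _+_ below (length-filterᵇ-∷ (suc x ≡ᵇ_) (suc (x + 0)) _) ⟩
  0 + ((if x ≡ᵇ x + 0 then 1 else 0) + length (filterᵇ (suc x ≡ᵇ_) (applyUpTo (λ t → suc (x + suc t)) r)))
    ≡⟨ cong₂ (λ b c → (if b then 1 else 0) + c) (trans (cong (x ≡ᵇ_) (+-identityʳ x)) (≡ᵇ-refl x)) above ⟩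
  1 ∎
  where
  open ≡-Reasoning
  below : length (filterᵇ (suc x ≡ᵇ_) (applyUpTo suc x)) ≡ 0
  below = length-filterᵇ-applyUpTo-none (suc x ≡ᵇ_) suc x 
            (λ {t} t<x eq → <-irrefl (sym (≡ᵇ⇒≡ (suc x) (suc t) eq)) (s≤s t<x))
  above : length (filterᵇ (suc x ≡ᵇ_) (applyUpTo (λ t → suc (x + suc t)) r)) ≡ 0
  above = length-filterᵇ-applyUpTo-none (suc x ≡ᵇ_) (λ t → suc (x + suc t)) r
            (λ _ eq → m+1+n≢m x (sym (≡ᵇ⇒≡ x _ eq)))

smnP : ℕ → List ℕ → Bool
smnP m w = allB (λ j → countOcc j w ≡ᵇ 1) (range1 m)

Arranges⇒smnP : ∀ n m w → Arranges n (suc m) w → smnP m w ≡ true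
Arranges⇒smnP n m w A =
  All⇒allB≡true (λ j → countOcc j w ≡ᵇ 1)
    (applyUpTo⁺₁ suc m (λ {t} t<m → T⇒≡true (≡⇒≡ᵇ _ 1 (once A (suc t) (s≤s z≤n) (s≤s t<m)))))

Smn-Arranges : ∀ m n → All (Arranges n (suc m)) (Smn m n)
Smn-Arranges m n = All.map toArranges (All-filterᵇ (smnP m) (All-words n (0 ∷ range1 m) letters<))
  where
  letters< : All (_< suc m) (0 ∷ range1 m)
  letters< = z<s ∷ applyUpTo⁺₁ suc m s≤s
  toArranges : ∀ {w} → smnP m w ≡ true × (length w ≡ n × All (_< suc m) w) → Arranges n (suc m) w
  toArranges {w} (isSmn , len , bnd) = record { length≡ = len ; bounded = bnd ; once = once′ }
    where
    once′ : ∀ c → 1 ≤ c → c < suc m → countOcc c w ≡ 1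
    once′ (suc t) _ c<1+m =
      ≡ᵇ≡true⇒≡ _ _ (applyUpTo⁻ suc m (allB≡true⇒All _ (range1 m) isSmn) (s≤s⁻¹ c<1+m))

Smn-unique : ∀ n m w → Arranges n (suc m) w → length (filterᵇ (eqList w) (Smn m n)) ≡ 1
Smn-unique n m w A = begin
  length (filterᵇ (eqList w) (Smn m n))
    ≡⟨ cong length (filterᵇ-filterᵇ-⇒ (eqList w) (smnP m) (words n (0 ∷ range1 m)) w≡⇒smnP) ⟩
  length (filterᵇ (eqList w) (words n (0 ∷ range1 m)))
    ≡⟨ cong (λ z → length (filterᵇ (eqList w) (words z (0 ∷ range1 m)))) (sym (length≡ A)) ⟩
  length (filterᵇ (eqList w) (words (length w) (0 ∷ range1 m)))
    ≡⟨ words-unique w (0 ∷ range1 m) (All.map (0∷range1-unique m _) (bounded A)) ⟩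
  1 ∎
  where
  open ≡-Reasoning
  w≡⇒smnP : ∀ s → eqList w s ≡ true → smnP m s ≡ true
  w≡⇒smnP s e rewrite sym (eqList⇒≡ w s e) = Arranges⇒smnP n m w A

words-length : ∀ n A → All (λ w → length w ≡ n) (words n A)
words-length n A = All.map proj₁ (All-words {P = λ _ → ⊤} n A (All.universal (λ _ → tt) A))

outcome-unique-in-Smn : ∀ k ℓ m n α → isJust (outcome k ℓ n α) ≡ true → length α ≡ m →
  length (filterᵇ (eqOutcome (outcome k ℓ n α)) (Smn m n)) ≡ 1
outcome-unique-in-Smn k ℓ m n α parks len with outcome k ℓ n α in e
... | just w = Smn-unique n m w (outcome-Arranges k ℓ m n α w len e)

PF-partition : ∀ k ℓ m n → length (PF k ℓ m n) ≡ sum (map (λ π → length (fiber k ℓ m n π)) (Smn m n))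
PF-partition k ℓ m n =
  length≡sum-length-filterᵇ (λ π α → eqOutcome (outcome k ℓ n α) π) (PF k ℓ m n) (Smn m n)
    (All.map (λ {α} (parks , len) → outcome-unique-in-Smn k ℓ m n α parks len)
             (All-filterᵇ (λ α → isJust (outcome k ℓ n α)) (words-length m (range1 n))))

-- The fibre of π as a product over cars

streetBefore : List ℕ → ℕ → List ℕ
streetBefore π j = map (λ v → if v <ᵇ j then v else 0) π

isSpotOf : List ℕ → ℕ → Maybe ℕ → Bool
isSpotOf π j nothing  = false
isSpotOf π j (just u) = at π u ≡ᵇ j

parksAsIn : ℕ → ℕ → ℕ → List ℕ → ℕ → ℕ → Bool
parksAsIn k ℓ n π j a = isSpotOf π j (firstEmpty (streetBefore π j) (candidates k ℓ n a))

allParkAsIn : ℕ → ℕ → ℕ → List ℕ → ℕ → List ℕ → Bool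
allParkAsIn k ℓ n π j []       = true
allParkAsIn k ℓ n π j (a ∷ as) = parksAsIn k ℓ n π j a ∧ allParkAsIn k ℓ n π (suc j) as

choices : ℕ → ℕ → ℕ → List ℕ → ℕ → ℕ
choices k ℓ n π j = length (filterᵇ (parksAsIn k ℓ n π j) (range1 n))

length-streetBefore : ∀ π j → length (streetBefore π j) ≡ length π
length-streetBefore π j = length-map _ π

streetBefore-1 : ∀ π → streetBefore π 1 ≡ replicate (length π) 0
streetBefore-1 []          = refl
streetBefore-1 (zero  ∷ π) = cong (0 ∷_) (streetBefore-1 π)
streetBefore-1 (suc x ∷ π) = cong (0 ∷_) (streetBefore-1 π)

streetBefore-all : ∀ j π → All (_< j) π → streetBefore π j ≡ π
streetBefore-all j []       []         = refl
streetBefore-all j (x ∷ π) (x<j ∷ ps) rewrite <⇒<ᵇ≡true x<j = cong (x ∷_) (streetBefore-all j π ps)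

<ᵇ-suc-≢ : ∀ x j → x ≢ j → (x <ᵇ j) ≡ (x <ᵇ suc j)
<ᵇ-suc-≢ x j x≢j with x <ᵇ j in x<?j
... | true  = sym (<⇒<ᵇ≡true (m≤n⇒m≤1+n (<ᵇ≡true⇒< x j x<?j)))
... | false = sym (≮⇒<ᵇ≡false x (suc j) (λ x<1+j → <ᵇ≡false⇒≮ x j x<?j (≤∧≢⇒< (s≤s⁻¹ x<1+j) x≢j)))

streetBefore-absent : ∀ j π → countOcc j π ≡ 0 → streetBefore π j ≡ streetBefore π (suc j)
streetBefore-absent j []      _ = refl
streetBefore-absent j (x ∷ π) e with x ≡ᵇ j in x≟j
... | false rewrite <ᵇ-suc-≢ x j (≡ᵇ≡false⇒≢ x j x≟j) = cong (_ ∷_) (streetBefore-absent j π e)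

streetBefore-park : ∀ π j u → at (streetBefore π j) u ≡ 0 → at π u ≡ j → countOcc j π ≡ 1 →
  setAt (streetBefore π j) u j ≡ streetBefore π (suc j)
streetBefore-park (x ∷ π) j (suc zero) _ refl once
  rewrite <⇒<ᵇ≡true (n<1+n x) | countOcc-∷ x x π | ≡ᵇ-refl x =
  cong (x ∷_) (streetBefore-absent x π (suc-injective once))
streetBefore-park (x ∷ π) j (suc (suc u)) vacant πu≡j once with x ≡ᵇ j in x≟j
... | true = ⊥-elim (<-irrefl refl (≤-trans (s≤s (countOcc-pos π (suc u) j πu≡j (s≤s z≤n) u≤)) (≤-reflexive once)))
  where
  u≤ : suc u ≤ length π
  u≤ = subst (suc u ≤_) (length-streetBefore π j) (proj₂ (vacant⇒inRange (streetBefore π j) (suc u) vacant))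
... | false rewrite <ᵇ-suc-≢ x j (≡ᵇ≡false⇒≢ x j x≟j) =
  cong (_ ∷_) (streetBefore-park π j (suc u) vacant πu≡j once)

parkFrom-preserves-occupied : ∀ k ℓ n j st as st′ u → parkFrom k ℓ n j st as ≡ just st′ →
  at st u ≢ 0 → at st′ u ≡ at st u
parkFrom-preserves-occupied k ℓ n j st [] st′ u refl _ = refl
parkFrom-preserves-occupied k ℓ n j st (a ∷ as) st′ u e occupied
  with firstEmpty st (candidates k ℓ n a) in found
... | just w = trans (parkFrom-preserves-occupied k ℓ n (suc j) (setAt st w j) as st′ u e (occupied ∘ trans (sym same))) same
  where
  same : at (setAt st w j) u ≡ at st u
  same = at-setAt-≢ st w u j
           (λ w≡u → occupied (subst (λ z → at st z ≡ 0) w≡u (firstEmpty-vacant st (candidates k ℓ n a) w found)))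

module _ (k ℓ m n : ℕ) (π : List ℕ) (A : Arranges n (suc m) π) where

  private
    parkFrom-misplaced : ∀ j as u → 1 ≤ j → at (streetBefore π j) u ≡ 0 → (at π u ≡ᵇ j) ≡ false →
      eqOutcome (parkFrom k ℓ n (suc j) (setAt (streetBefore π j) u j) as) π ≡ false
    parkFrom-misplaced j as u 1≤j vacant πu≢j with parkFrom k ℓ n (suc j) (setAt (streetBefore π j) u j) as in parked
    ... | nothing = refl
    ... | just st′ with eqList st′ π in st′≡π
    ...   | false = refl
    ...   | true  = ⊥-elim (≡ᵇ≡false⇒≢ (at π u) j πu≢j (begin
      at π u                                    ≡⟨ cong (λ z → at z u) (eqList⇒≡ st′ π st′≡π) ⟨
      at st′ u                                  ≡⟨ parkFrom-preserves-occupied k ℓ n (suc j) _ as st′ u parked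
                                                     (λ z → <-irrefl (sym (trans (sym carJ) z)) 1≤j) ⟩
      at (setAt (streetBefore π j) u j) u       ≡⟨ carJ ⟩
      j                                         ∎))
      where
      open ≡-Reasoning
      carJ : at (setAt (streetBefore π j) u j) u ≡ j
      carJ = at-setAt-≡ (streetBefore π j) u j vacant

  eqOutcome-parkFrom-streetBefore : ∀ as j → 1 ≤ j → j + length as ≡ suc m →
    eqOutcome (parkFrom k ℓ n j (streetBefore π j) as) π ≡ allParkAsIn k ℓ n π j as
  eqOutcome-parkFrom-streetBefore [] j _ e rewrite +-identityʳ j | e | streetBefore-all (suc m) π (bounded A) =
    eqList-refl π
  eqOutcome-parkFrom-streetBefore (a ∷ as) j 1≤j e with firstEmpty (streetBefore π j) (candidates k ℓ n a) in found
  ... | nothing = refl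
  ... | just u with at π u ≡ᵇ j in πu≟j
  ...   | false = parkFrom-misplaced j as u 1≤j (firstEmpty-vacant _ (candidates k ℓ n a) u found) πu≟j
  ...   | true rewrite streetBefore-park π j u (firstEmpty-vacant _ (candidates k ℓ n a) u found) (≡ᵇ≡true⇒≡ _ _ πu≟j)
                         (once A j 1≤j (subst (j <_) e (m<m+n j z<s))) =
    eqOutcome-parkFrom-streetBefore as (suc j) (s≤s z≤n) e′
    where
    e′ : suc j + length as ≡ suc m
    e′ = trans (sym (+-suc j (length as))) e

prodFrom : (ℕ → ℕ) → ℕ → ℕ → ℕ
prodFrom g j zero    = 1
prodFrom g j (suc m) = g j * prodFrom g (suc j) m

length-filterᵇ-allParkAsIn : ∀ k ℓ n π A m j →
  length (filterᵇ (allParkAsIn k ℓ n π j) (words m A))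
    ≡ prodFrom (λ c → length (filterᵇ (parksAsIn k ℓ n π c) A)) j m
length-filterᵇ-allParkAsIn k ℓ n π A zero j = refl
length-filterᵇ-allParkAsIn k ℓ n π A (suc m) j
  rewrite length-filterᵇ-words-∷ (parksAsIn k ℓ n π j) (allParkAsIn k ℓ n π (suc j)) (allParkAsIn k ℓ n π j)
            (words m A) A (λ a s → refl) =
  cong (length (filterᵇ (parksAsIn k ℓ n π j) A) *_) (length-filterᵇ-allParkAsIn k ℓ n π A m (suc j))

length-fiber : ∀ k ℓ m n π → Arranges n (suc m) π → length (fiber k ℓ m n π) ≡ prodFrom (choices k ℓ n π) 1 m
length-fiber k ℓ m n π A = begin
  length (fiber k ℓ m n π)
    ≡⟨ cong length (filterᵇ-filterᵇ-⇒ _ _ (words m (range1 n)) reaches⇒parks) ⟩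
  length (filterᵇ (λ α → eqOutcome (outcome k ℓ n α) π) (words m (range1 n)))
    ≡⟨ cong length (filterᵇ-cong-local _ _ (words m (range1 n)) (All.map (λ {α} → reaches≡allPark α) (words-length m (range1 n)))) ⟩
  length (filterᵇ (allParkAsIn k ℓ n π 1) (words m (range1 n)))
    ≡⟨ length-filterᵇ-allParkAsIn k ℓ n π (range1 n) m 1 ⟩
  prodFrom (choices k ℓ n π) 1 m ∎
  where
  open ≡-Reasoning
  reaches⇒parks : ∀ α → eqOutcome (outcome k ℓ n α) π ≡ true → isJust (outcome k ℓ n α) ≡ true
  reaches⇒parks α e with outcome k ℓ n α
  ... | just _ = refl
  empty≡ : replicate n 0 ≡ streetBefore π 1
  empty≡ = trans (cong (λ z → replicate z 0) (sym (length≡ A))) (sym (streetBefore-1 π))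
  reaches≡allPark : ∀ α → length α ≡ m → eqOutcome (outcome k ℓ n α) π ≡ allParkAsIn k ℓ n π 1 α
  reaches≡allPark α len = trans (cong (λ z → eqOutcome (parkFrom k ℓ n 1 z α) π) empty≡)
                                  (eqOutcome-parkFrom-streetBefore k ℓ m n π A α 1 (s≤s z≤n) (cong suc len))

-- Products over cars and over spots

prodFrom-snoc : ∀ g j m → prodFrom g j (suc m) ≡ prodFrom g j m * g (j + m)
prodFrom-snoc g j zero rewrite +-identityʳ j = trans (*-identityʳ (g j)) (sym (+-identityʳ (g j)))
prodFrom-snoc g j (suc m) rewrite prodFrom-snoc g (suc j) m | +-suc j m =
  sym (*-assoc (g j) (prodFrom g (suc j) m) (g (suc (j + m))))

oneAtZero : (ℕ → ℕ) → ℕ → ℕ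
oneAtZero g zero    = 1
oneAtZero g (suc j) = g (suc j)

prodFrom-oneAtZero : ∀ g j m → prodFrom (oneAtZero g) (suc j) m ≡ prodFrom g (suc j) m
prodFrom-oneAtZero g j zero    = refl
prodFrom-oneAtZero g j (suc m) = cong (g (suc j) *_) (prodFrom-oneAtZero g (suc j) m)

vacate : ℕ → List ℕ → List ℕ
vacate c = map (λ v → if v ≡ᵇ c then 0 else v)

vacate-absent : ∀ c w → countOcc c w ≡ 0 → vacate c w ≡ w
vacate-absent c []      _ = refl
vacate-absent c (x ∷ w) e with x ≡ᵇ c
... | false = cong (x ∷_) (vacate-absent c w e)

product-map-vacate : ∀ (G : ℕ → ℕ) c w → G 0 ≡ 1 → countOcc c w ≡ 1 →
  product (map G w) ≡ G c * product (map G (vacate c w))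
product-map-vacate G c (x ∷ w) G0≡1 once with x ≡ᵇ c in x≟c
... | true rewrite G0≡1 | vacate-absent c w (suc-injective once) | ≡ᵇ≡true⇒≡ x c x≟c
                 | *-identityˡ (product (map G w)) = refl
... | false rewrite product-map-vacate G c w G0≡1 once = x*[y*z]≡y*[x*z] (G x) (G c) _
  where
  x*[y*z]≡y*[x*z] : ∀ x y z → x * (y * z) ≡ y * (x * z)
  x*[y*z]≡y*[x*z] = solve-∀

countOcc-vacate : ∀ c c′ w → c′ ≢ c → c′ ≢ 0 → countOcc c′ (vacate c w) ≡ countOcc c′ w
countOcc-vacate c c′ []      _ _ = refl
countOcc-vacate c c′ (x ∷ w) c′≢c c′≢0 with x ≡ᵇ c in x≟c
... | true rewrite countOcc-∷ c′ 0 (vacate c w) | countOcc-∷ c′ x w | ≢⇒≡ᵇ≡false 0 c′ (c′≢0 ∘ sym)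
                 | ≡ᵇ≡true⇒≡ x c x≟c | ≢⇒≡ᵇ≡false c c′ (c′≢c ∘ sym) = countOcc-vacate c c′ w c′≢c c′≢0
... | false rewrite countOcc-∷ c′ x (vacate c w) | countOcc-∷ c′ x w =
  cong ((if x ≡ᵇ c′ then 1 else 0) +_) (countOcc-vacate c c′ w c′≢c c′≢0)

All-vacate : ∀ m w → All (_< suc (suc m)) w → All (_< suc m) (vacate (suc m) w)
All-vacate m []      []         = []
All-vacate m (x ∷ w) (x<2+m ∷ ps) with x ≡ᵇ suc m in x≟1+m
... | true  = z<s ∷ All-vacate m w ps
... | false = ≤∧≢⇒< (s≤s⁻¹ x<2+m) (≡ᵇ≡false⇒≢ x (suc m) x≟1+m) ∷ All-vacate m w ps

Arranges-vacate : ∀ n m w → Arranges n (suc (suc m)) w → Arranges n (suc m) (vacate (suc m) w)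
Arranges-vacate n m w A = record
  { length≡ = trans (length-map _ w) (length≡ A)
  ; bounded = All-vacate m w (bounded A)
  ; once    = λ c 1≤c c<1+m → trans (countOcc-vacate (suc m) c w (λ c≡ → <-irrefl c≡ c<1+m) (λ c≡0 → <-irrefl (sym c≡0) 1≤c))
                                    (once A c 1≤c (m≤n⇒m≤1+n c<1+m))
  }

product-map-zeros : ∀ (G : ℕ → ℕ) w → G 0 ≡ 1 → All (_< 1) w → product (map G w) ≡ 1
product-map-zeros G []       _    []         = refl
product-map-zeros G (zero ∷ w) G0≡1 (_ ∷ ps) rewrite G0≡1 | product-map-zeros G w G0≡1 ps = refl
product-map-zeros G (suc _ ∷ w) _   (s≤s () ∷ _)

product-map-Arranges : ∀ (G : ℕ → ℕ) n m w → G 0 ≡ 1 → Arranges n (suc m) w → product (map G w) ≡ prodFrom G 1 m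
product-map-Arranges G n zero    w G0≡1 A = product-map-zeros G w G0≡1 (bounded A)
product-map-Arranges G n (suc m) w G0≡1 A = begin
  product (map G w)                              ≡⟨ product-map-vacate G (suc m) w G0≡1 (once A (suc m) (s≤s z≤n) ≤-refl) ⟩
  G (suc m) * product (map G (vacate (suc m) w)) ≡⟨ cong (G (suc m) *_) (product-map-Arranges G n m _ G0≡1 (Arranges-vacate n m w A)) ⟩
  G (suc m) * prodFrom G 1 m                     ≡⟨ *-comm (G (suc m)) _ ⟩
  prodFrom G 1 m * G (suc m)                     ≡⟨ prodFrom-snoc G 1 m ⟨
  prodFrom G 1 (suc m)                           ∎
  where open ≡-Reasoning

weight≡product-map : ∀ k ℓ n π (G : ℕ → ℕ) → length π ≡ n →
  (∀ t → t < n → factor k ℓ π (suc t) ≡ G (at π (suc t))) → weight k ℓ n π ≡ product (map G π)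
weight≡product-map k ℓ n π G refl factor≡ = cong product (begin
  map (factor k ℓ π) (applyUpTo suc (length π))          ≡⟨ map-applyUpTo suc (factor k ℓ π) (length π) ⟩
  applyUpTo (factor k ℓ π ∘ suc) (length π)              ≡⟨ applyUpTo-cong-< _ _ (length π) factor≡ ⟩
  applyUpTo (λ t → G (at π (suc t))) (length π)          ≡⟨ applyUpTo-at π ⟩
  map G π                                                ∎)
  where
  open ≡-Reasoning
  applyUpTo-at : ∀ π → applyUpTo (λ t → G (at π (suc t))) (length π) ≡ map G π
  applyUpTo-at []      = refl
  applyUpTo-at (x ∷ π) = cong (G x ∷_) (applyUpTo-at π)

-- The preferences that send a car to a vacant spot

lt-split : ∀ {x y} → x < y → Σ ℕ λ d → y ≡ suc (x + d)
lt-split {x} {y} x<y = y ∸ suc x , sym (m+[n∸m]≡n x<y)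

le-split : ∀ {x y} → x ≤ y → Σ ℕ λ r → y ≡ x + r
le-split {x} {y} x≤y = y ∸ x , sym (m+[n∸m]≡n x≤y)

backward : ℕ → ℕ → List ℕ
backward k a = applyUpTo (λ t → a ∸ suc t) (k ⊓ (a ∸ 1))

forward : ℕ → ℕ → ℕ → List ℕ
forward ℓ n a = applyUpTo (λ t → a + suc t) (ℓ ⊓ (n ∸ a))

candidates-split : ∀ k ℓ n a → candidates k ℓ n a ≡ a ∷ (backward k a ++ forward ℓ n a)
candidates-split k ℓ n a =
  cong (a ∷_) (cong₂ _++_ (map-applyUpTo suc (a ∸_) (k ⊓ (a ∸ 1))) (map-applyUpTo suc (a +_) (ℓ ⊓ (n ∸ a))))

-- i − F ≤ a ≤ i + B, stated without truncated subtraction.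
inWindow : ℕ → ℕ → ℕ → ℕ → Bool
inWindow i F B a = (i ≤ᵇ a + F) ∧ (a ≤ᵇ i + B)

inWindow≡true : ∀ {i F B a} → i ≤ a + F → a ≤ i + B → inWindow i F B a ≡ true
inWindow≡true lo hi rewrite ≤⇒≤ᵇ≡true lo | ≤⇒≤ᵇ≡true hi = refl

inWindow≡false : ∀ i F B a → ¬ (i ≤ a + F × a ≤ i + B) → inWindow i F B a ≡ false
inWindow≡false i F B a out with i ≤? a + F | a ≤? i + B
... | yes lo | yes hi = ⊥-elim (out (lo , hi))
... | no ¬lo | _      rewrite ≰⇒≤ᵇ≡false _ _ ¬lo = refl
... | yes lo | no ¬hi rewrite ≤⇒≤ᵇ≡true lo | ≰⇒≤ᵇ≡false _ _ ¬hi = refl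

inWindow-below : ∀ i F B a → a + F < i → ¬ T (inWindow i F B a)
inWindow-below i F B a a+F<i inside = <⇒≱ a+F<i (≤ᵇ⇒≤ _ _ (proj₁ (Equivalence.to T-∧ inside)))

inWindow-above : ∀ i F B a → i + B < a → ¬ T (inWindow i F B a)
inWindow-above i F B a i+B<a inside = <⇒≱ i+B<a (≤ᵇ⇒≤ _ _ (proj₂ (Equivalence.to T-∧ inside)))

length-window : ∀ i F B n → F < i → i + B ≤ n → length (filterᵇ (inWindow i F B) (range1 n)) ≡ B + F + 1
length-window i F B n F<i i+B≤n with lt-split F<i
... | lo , refl with le-split i+B≤n
...   | r , refl = begin
  count (applyUpTo suc (suc (F + lo) + B + r))
    ≡⟨ cong (count ∘ applyUpTo suc) (shape F lo B r) ⟩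
  count (applyUpTo suc (lo + (suc (F + B) + r)))
    ≡⟨ cong count (applyUpTo-+ suc lo _) ⟩
  count (applyUpTo suc lo ++ applyUpTo (λ t → suc (lo + t)) (suc (F + B) + r))
    ≡⟨ length-filterᵇ-++ p (applyUpTo suc lo) _ ⟩
  count (applyUpTo suc lo) + count (applyUpTo (λ t → suc (lo + t)) (suc (F + B) + r))
    ≡⟨ cong₂ _+_ (length-filterᵇ-applyUpTo-none p suc lo below) (cong count (applyUpTo-+ (λ t → suc (lo + t)) (suc (F + B)) r)) ⟩
  0 + count (applyUpTo (λ t → suc (lo + t)) (suc (F + B)) ++ applyUpTo (λ t → suc (lo + (suc (F + B) + t))) r)
    ≡⟨ length-filterᵇ-++ p (applyUpTo (λ t → suc (lo + t)) (suc (F + B))) _ ⟩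
  count (applyUpTo (λ t → suc (lo + t)) (suc (F + B))) + count (applyUpTo (λ t → suc (lo + (suc (F + B) + t))) r)
    ≡⟨ cong₂ _+_ (length-filterᵇ-applyUpTo-all p (λ t → suc (lo + t)) (suc (F + B)) inside)
                  (length-filterᵇ-applyUpTo-none p (λ t → suc (lo + (suc (F + B) + t))) r above) ⟩
  suc (F + B) + 0
    ≡⟨ tidy F B ⟩
  B + F + 1 ∎
  where
  open ≡-Reasoning
  c : ℕ
  c = suc (F + lo)
  p : ℕ → Bool
  p = inWindow c F B
  count : List ℕ → ℕ
  count xs = length (filterᵇ p xs)
  shape : ∀ F lo B r → suc (F + lo) + B + r ≡ lo + (suc (F + B) + r)
  shape = solve-∀
  tidy : ∀ F B → suc (F + B) + 0 ≡ B + F + 1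
  tidy = solve-∀
  reassoc : ∀ F lo B → lo + (F + B) ≡ F + lo + B
  reassoc = solve-∀
  reassoc′ : ∀ F lo B → lo + suc (F + B) ≡ suc (F + lo + B)
  reassoc′ = solve-∀
  below : ∀ {t} → t < lo → ¬ T (p (suc t))
  below {t} t<lo = inWindow-below c F B (suc t) (s≤s (subst (t + F <_) (+-comm lo F) (+-monoˡ-< F t<lo)))
  inside : ∀ {t} → t < suc (F + B) → T (p (suc (lo + t)))
  inside {t} t≤F+B = ≡true⇒T (inWindow≡true
    (s≤s (subst (_≤ lo + t + F) (+-comm lo F) (+-monoˡ-≤ F (m≤m+n lo t))))
    (s≤s (subst (lo + t ≤_) (reassoc F lo B) (+-monoʳ-≤ lo (s≤s⁻¹ t≤F+B)))))
  above : ∀ {t} → t < r → ¬ T (p (suc (lo + (suc (F + B) + t))))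
  above {t} _ = inWindow-above c F B _ (s≤s (subst (_≤ lo + (suc (F + B) + t)) (reassoc′ F lo B) (+-monoʳ-≤ lo (m≤m+n (suc (F + B)) t))))

forwardReach : ℕ → ℕ → ℕ → ℕ → ℕ
forwardReach k ℓ i0 zero    = 0
forwardReach k ℓ i0 (suc L) = if suc L ≡ᵇ i0 then i0 ⊓ ℓ else (suc L ∸ k) ⊓ ℓ

F≡forwardReach : ∀ k ℓ π i0 → F k ℓ π (suc i0) ≡ forwardReach k ℓ i0 (Left π (suc i0))
F≡forwardReach k ℓ π i0 with Left π (suc i0)
... | zero  = refl
... | suc L = refl

forwardReach-cases : ∀ k ℓ i0 L → L ≤ i0 →
  (L ≡ i0 × forwardReach k ℓ i0 L ≡ i0 ⊓ ℓ) ⊎ (L < i0 × forwardReach k ℓ i0 L ≡ (L ∸ k) ⊓ ℓ)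
forwardReach-cases k ℓ zero     zero    _   = inj₁ (refl , refl)
forwardReach-cases k ℓ (suc i0) zero    _   rewrite 0∸n≡0 k = inj₂ (z<s , refl)
forwardReach-cases k ℓ i0       (suc L) L≤ with suc L ≡ᵇ i0 in L≟i0
... | true  = inj₁ (≡ᵇ≡true⇒≡ _ _ L≟i0 , refl)
... | false = inj₂ (≤∧≢⇒< L≤ (≡ᵇ≡false⇒≢ _ _ L≟i0) , refl)

forwardReach≤ : ∀ k ℓ i0 L → L ≤ i0 → forwardReach k ℓ i0 L ≤ L
forwardReach≤ k ℓ i0 L L≤i0 with forwardReach-cases k ℓ i0 L L≤i0
... | inj₁ (refl , eF) rewrite eF = m⊓n≤m L ℓ
... | inj₂ (_ , eF)    rewrite eF = ≤-trans (m⊓n≤m (L ∸ k) ℓ) (m∸n≤m L k)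

-- A car preferring spot a′ + 1 = i − (d + 1) reaches i exactly when its forward budget covers d + 1 and the
-- whole stretch it inspects, its backward window and the d + 1 spots up to i, lies in the left run.
≤forwardReach⇒ : ∀ k ℓ i0 L a′ d → L ≤ i0 → a′ + suc d ≡ i0 →
  suc d ≤ forwardReach k ℓ i0 L → suc d ≤ ℓ × suc d + k ⊓ a′ ≤ L
≤forwardReach⇒ k ℓ i0 L a′ d L≤i0 e d< with forwardReach-cases k ℓ i0 L L≤i0
... | inj₁ (L≡i0 , eF) = ≤-trans d< (≤-trans (≤-reflexive eF) (m⊓n≤n i0 ℓ))
                       , ≤-trans (+-monoʳ-≤ (suc d) (m⊓n≤n k a′)) (≤-reflexive (trans (+-comm (suc d) a′) (trans e (sym L≡i0))))
... | inj₂ (_ , eF) = ≤-trans d<F (m⊓n≤n (L ∸ k) ℓ)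
                    , ≤-trans (+-monoʳ-≤ (suc d) (m⊓n≤m k a′)) (m≤o∸n⇒m+n≤o (suc d) k≤L d≤L∸k)
  where
  d<F : suc d ≤ (L ∸ k) ⊓ ℓ
  d<F = subst (suc d ≤_) eF d<
  d≤L∸k : suc d ≤ L ∸ k
  d≤L∸k = ≤-trans d<F (m⊓n≤m (L ∸ k) ℓ)
  k≤L : k ≤ L
  k≤L = <⇒≤ (m∸n≢0⇒n<m (λ L∸k≡0 → <⇒≱ (subst (0 <_) L∸k≡0 (≤-trans z<s d≤L∸k)) ≤-refl))

⇒≤forwardReach : ∀ k ℓ i0 L a′ d → L ≤ i0 → a′ + suc d ≡ i0 →
  suc d ≤ ℓ → suc d + k ⊓ a′ ≤ L → suc d ≤ forwardReach k ℓ i0 L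
⇒≤forwardReach k ℓ i0 L a′ d L≤i0 e d≤ℓ stretch with forwardReach-cases k ℓ i0 L L≤i0
... | inj₁ (_ , eF) = subst (suc d ≤_) (sym eF) (⊓-glb (subst (suc d ≤_) e (m≤n+m (suc d) a′)) d≤ℓ)
... | inj₂ (L<i0 , eF) with k ≤? a′
...   | yes k≤a′ = subst (suc d ≤_) (sym eF)
                     (⊓-glb (m+n≤o⇒m≤o∸n (suc d) (subst (λ x → suc d + x ≤ L) (m≤n⇒m⊓n≡m k≤a′) stretch)) d≤ℓ)
...   | no k≰a′ = ⊥-elim (<⇒≱ L<i0 (subst (_≤ L) stretch≡i0 stretch))
  where
  stretch≡i0 : suc d + k ⊓ a′ ≡ i0
  stretch≡i0 = trans (cong (suc d +_) (m≥n⇒m⊓n≡n (<⇒≤ (≰⇒> k≰a′)))) (trans (+-comm (suc d) a′) e)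

backward-window-in-run : ∀ a′ t d K L → t < K → K ≤ a′ → suc d + K ≤ L → suc a′ + suc d ≤ a′ ∸ t + L
backward-window-in-run a′ t d K L t<K K≤a′ stretch = begin
  suc a′ + suc d               ≡⟨ cong (λ x → suc x + suc d) (m∸n+n≡m t≤a′) ⟨
  suc (a′ ∸ t + t) + suc d     ≡⟨ rearrange (a′ ∸ t) t d ⟩
  a′ ∸ t + (suc d + suc t)     ≤⟨ +-monoʳ-≤ (a′ ∸ t) (+-monoʳ-≤ (suc d) t<K) ⟩
  a′ ∸ t + (suc d + K)         ≤⟨ +-monoʳ-≤ (a′ ∸ t) stretch ⟩
  a′ ∸ t + L                   ∎
  where
  open ≤-Reasoning
  t≤a′ : t ≤ a′
  t≤a′ = ≤-trans (n≤1+n t) (≤-trans t<K K≤a′)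
  rearrange : ∀ s t d → suc (s + t) + suc d ≡ s + (suc d + suc t)
  rearrange = solve-∀

m+d∸p<d : ∀ m d p → m < p → p ≤ m + d → m + d ∸ p < d
m+d∸p<d m d p m<p p≤m+d with lt-split m<p
... | q , refl with lt-split (+-cancelˡ-< m q d p≤m+d)
...   | r , refl = subst (_< suc (q + r)) (sym m+d∸p≡r) (s≤s (m≤n+m r q))
  where
  reassoc : ∀ m q r → m + suc (q + r) ≡ suc (m + q) + r
  reassoc = solve-∀
  m+d∸p≡r : m + suc (q + r) ∸ suc (m + q) ≡ r
  m+d∸p≡r = trans (cong (_∸ suc (m + q)) (reassoc m q r)) (m+n∸m≡n (suc (m + q)) r)

module VacantSpot (k ℓ n : ℕ) (st : List ℕ) (i0 R L : ℕ)
  (i≤n : suc i0 ≤ n) (vacant : at st (suc i0) ≡ 0)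
  (right-occupied : ∀ p → suc i0 < p → p ≤ suc i0 + R → at st p ≢ 0)
  (right-end : suc i0 + R < n → at st (suc (suc i0 + R)) ≡ 0)
  (L≤i0 : L ≤ i0)
  (left-occupied : ∀ p → suc i0 ≤ p + L → p < suc i0 → at st p ≢ 0)
  (left-end : ∀ p → 1 ≤ p → p + L ≡ i0 → at st p ≡ 0) where

  i : ℕ
  i = suc i0

  Fᵢ : ℕ
  Fᵢ = forwardReach k ℓ i0 L

  right-run-maximal : ∀ d → (∀ p → i < p → p ≤ i + d → at st p ≢ 0) → i + d ≤ n → d ≤ R
  right-run-maximal d occupied i+d≤n = ≮⇒≥ λ R<d →
    occupied (suc (i + R)) (s≤s (m≤m+n i R)) (past R<d) (right-end (≤-trans (past R<d) i+d≤n))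
    where
    past : R < d → suc (i + R) ≤ i + d
    past R<d = subst (_≤ i + d) (+-suc i R) (+-monoʳ-≤ i R<d)

  left-run-maximal : ∀ d → d ≤ i0 → (∀ p → i ≤ p + d → p < i → at st p ≢ 0) → d ≤ L
  left-run-maximal d d≤i0 occupied = ≮⇒≥ λ L<d →
    occupied (i0 ∸ L) (past L<d) (s≤s (m∸n≤m i0 L))
      (left-end (i0 ∸ L) (m<n⇒0<n∸m (≤-trans L<d d≤i0)) (m∸n+n≡m L≤i0))
    where
    past : L < d → i ≤ i0 ∸ L + d
    past L<d = ≤-trans (≤-reflexive (trans (cong suc (sym (m∸n+n≡m L≤i0))) (sym (+-suc (i0 ∸ L) L))))
                       (+-monoʳ-≤ (i0 ∸ L) L<d)

  firstEmpty-split : ∀ a → firstEmpty st (candidates k ℓ n a) ≡ firstEmpty st (a ∷ (backward k a ++ forward ℓ n a))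
  firstEmpty-split a = cong (firstEmpty st) (candidates-split k ℓ n a)

  lands-from-right : ∀ d → suc d ≤ R → suc d ≤ k → firstEmpty st (candidates k ℓ n (suc (i + d))) ≡ just i
  lands-from-right d d<R d<k =
    trans (firstEmpty-split a)
    (trans (firstEmpty-∷-occupied st a (backward k a ++ forward ℓ n a) (right-occupied a (s≤s (m≤m+n i d)) a≤i+R))
    (trans (firstEmpty-hit st (λ t → a ∸ suc t) (k ⊓ (i + d)) (forward ℓ n a) d d<K between vacant′)
           (cong just (m+n∸n≡m i d))))
    where
    a : ℕ
    a = suc (i + d)
    a≤i+R : a ≤ i + R
    a≤i+R = subst (_≤ i + R) (+-suc i d) (+-monoʳ-≤ i d<R)
    d<K : d < k ⊓ (i + d)
    d<K = ⊓-glb d<k (s≤s (m≤n+m d i0))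
    between : ∀ t → t < d → at st (i + d ∸ t) ≢ 0
    between t t<d = right-occupied _ (subst (i <_) (sym (+-∸-assoc i (<⇒≤ t<d))) (m<m+n i (m<n⇒0<n∸m t<d)))
                                     (≤-trans (m∸n≤m (i + d) t) (+-monoʳ-≤ i (≤-trans (n≤1+n d) d<R)))
    vacant′ : at st (i + d ∸ d) ≡ 0
    vacant′ = subst (λ p → at st p ≡ 0) (sym (m+n∸n≡m i d)) vacant

  lands-from-right⇒ : ∀ d → suc (i + d) ≤ n → firstEmpty st (candidates k ℓ n (suc (i + d))) ≡ just i →
    suc d ≤ R × suc d ≤ k
  lands-from-right⇒ d a≤n found
    with firstEmpty-∷-just st (suc (i + d)) (backward k (suc (i + d)) ++ forward ℓ n (suc (i + d))) i (trans (sym (firstEmpty-split (suc (i + d)))) found)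
                           (λ a≡i → <-irrefl (sym a≡i) (s≤s (m≤m+n i d)))
  ... | a-occupied , found′ with firstEmpty-++-inv st (λ t → i + d ∸ t) (k ⊓ (i + d)) (forward ℓ n (suc (i + d))) i found′
  ...   | inj₂ (_ , found″) with firstEmpty-applyUpTo-inv st (λ t → suc (i + d) + suc t) (ℓ ⊓ (n ∸ suc (i + d))) i found″
  ...     | (_ , _ , i≡ , _) = ⊥-elim (<-irrefl i≡ (≤-trans (s≤s (m≤m+n i d)) (m≤m+n _ _)))
  lands-from-right⇒ d a≤n found | a-occupied , found′ | inj₁ (r , r<K , i≡ , occupied) =
    right-run-maximal (suc d) upto-a (subst (_≤ n) (sym (+-suc i d)) a≤n) , subst (λ x → suc x ≤ k) r≡d (≤-trans r<K (m⊓n≤m k _))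
    where
    r≤i+d : r ≤ i + d
    r≤i+d = ≤-trans (<⇒≤ r<K) (m⊓n≤n k (i + d))
    r≡d : r ≡ d
    r≡d = +-cancelˡ-≡ i r d (trans (+-comm i r) (trans (cong (r +_) i≡) (trans (+-comm r (i + d ∸ r)) (m∸n+n≡m r≤i+d))))
    upto-a : ∀ p → i < p → p ≤ i + suc d → at st p ≢ 0
    upto-a p i<p p≤ with p ≟ suc (i + d)
    ... | yes refl = a-occupied
    ... | no p≢a = subst (λ x → at st x ≢ 0) (m∸[m∸n]≡n p≤i+d) (occupied (i + d ∸ p) (subst (i + d ∸ p <_) (sym r≡d) i+d∸p<d))
      where
      p≤i+d : p ≤ i + d
      p≤i+d = s≤s⁻¹ (≤∧≢⇒< (subst (p ≤_) (+-suc i d) p≤) p≢a)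
      i+d∸p<d : i + d ∸ p < d
      i+d∸p<d = m+d∸p<d i d p i<p p≤i+d

  a<i : ∀ a′ d → i ≡ suc (suc a′ + d) → suc a′ < i
  a<i a′ d eI = subst (suc a′ <_) (sym eI) (s≤s (m≤m+n (suc a′) d))

  lands-from-left : ∀ a′ d → i ≡ suc (suc a′ + d) → suc d ≤ ℓ → suc d + k ⊓ a′ ≤ L →
    firstEmpty st (candidates k ℓ n (suc a′)) ≡ just i
  lands-from-left a′ d eI d≤ℓ stretch =
    trans (firstEmpty-split a)
    (trans (firstEmpty-∷-occupied st a (backward k a ++ forward ℓ n a) (left-occupied a i≤a+L (a<i a′ d eI)))
    (trans (firstEmpty-skip st (λ t → a′ ∸ t) (k ⊓ a′) (forward ℓ n a) backward-occupied)
    (trans (firstEmpty-applyUpTo-hit st (λ t → a + suc t) (ℓ ⊓ (n ∸ a)) d d<M forward-occupied vacant′)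
           (cong just aI))))
    where
    a : ℕ
    a = suc a′
    aI : a + suc d ≡ i
    aI = trans (+-suc a d) (sym eI)
    i≤a+L : i ≤ a + L
    i≤a+L = subst (_≤ a + L) aI (+-monoʳ-≤ a (≤-trans (m≤m+n (suc d) _) stretch))
    backward-occupied : ∀ t → t < k ⊓ a′ → at st (a′ ∸ t) ≢ 0
    backward-occupied t t<K =
      left-occupied _ (subst (_≤ a′ ∸ t + L) aI (backward-window-in-run a′ t d (k ⊓ a′) L t<K (m⊓n≤n k a′) stretch))
                      (≤-trans (s≤s (m∸n≤m a′ t)) (<⇒≤ (a<i a′ d eI)))
    forward-occupied : ∀ t → t < d → at st (a + suc t) ≢ 0
    forward-occupied t t<d =
      left-occupied _ (≤-trans i≤a+L (+-monoˡ-≤ L (m≤m+n a (suc t)))) (subst (a + suc t <_) aI (+-monoʳ-< a (s≤s t<d)))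
    d<M : d < ℓ ⊓ (n ∸ a)
    d<M = ⊓-glb d≤ℓ (m+n≤o⇒m≤o∸n (suc d) (≤-trans (≤-reflexive (trans (+-comm (suc d) a) aI)) i≤n))
    vacant′ : at st (a + suc d) ≡ 0
    vacant′ = subst (λ p → at st p ≡ 0) (sym aI) vacant

  left-stretch-occupied : ∀ a′ d → i ≡ suc (suc a′ + d) → at st (suc a′) ≢ 0 →
    (∀ t → t < k ⊓ a′ → at st (a′ ∸ t) ≢ 0) → (∀ t → t < d → at st (suc a′ + suc t) ≢ 0) →
    ∀ p → i ≤ p + (suc d + k ⊓ a′) → p < i → at st p ≢ 0
  left-stretch-occupied a′ d eI a-occupied backward-occupied forward-occupied p i≤ p<i with <-cmp p (suc a′)
  ... | tri≈ _ refl _ = a-occupied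
  ... | tri> _ _ a<p with lt-split a<p
  ...   | q , refl = subst (λ x → at st x ≢ 0) (+-suc (suc a′) q) (forward-occupied q q<d)
    where
    q<d : q < d
    q<d = +-cancelˡ-< (suc a′) q d (s≤s⁻¹ (subst (suc (suc a′ + q) <_) eI p<i))
  left-stretch-occupied a′ d eI _ backward-occupied _ p i≤ p<i | tri< p<a _ _ with lt-split p<a
  ... | q , refl = subst (λ x → at st x ≢ 0) (m+n∸n≡m p q) (backward-occupied q q<K)
    where
    reassocˡ : ∀ p q d → suc (suc (p + q) + d) ≡ (p + suc d) + suc q
    reassocˡ = solve-∀
    reassocʳ : ∀ p d K → p + (suc d + K) ≡ (p + suc d) + K
    reassocʳ = solve-∀
    q<K : q < k ⊓ (p + q)
    q<K = +-cancelˡ-≤ (p + suc d) (suc q) (k ⊓ (p + q))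
            (subst₂ _≤_ (trans eI (reassocˡ p q d)) (reassocʳ p d (k ⊓ (p + q))) i≤)

  lands-from-left⇒ : ∀ a′ d → i ≡ suc (suc a′ + d) → firstEmpty st (candidates k ℓ n (suc a′)) ≡ just i →
    suc d ≤ ℓ × suc d + k ⊓ a′ ≤ L
  lands-from-left⇒ a′ d eI found
    with firstEmpty-∷-just st (suc a′) (backward k (suc a′) ++ forward ℓ n (suc a′)) i (trans (sym (firstEmpty-split (suc a′))) found) (<⇒≢ (a<i a′ d eI))
  ... | a-occupied , found′ with firstEmpty-++-inv st (λ t → a′ ∸ t) (k ⊓ a′) (forward ℓ n (suc a′)) i found′
  ...   | inj₁ (r , _ , i≡ , _) = ⊥-elim (<⇒≱ (a<i a′ d eI) (≤-trans (≤-reflexive i≡) (≤-trans (m∸n≤m a′ r) (n≤1+n a′))))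
  ...   | inj₂ (backward-occupied , found″) with firstEmpty-applyUpTo-inv st (λ t → suc a′ + suc t) (ℓ ⊓ (n ∸ suc a′)) i found″
  ...     | (r , r<M , i≡ , forward-occupied) =
    subst (λ x → suc x ≤ ℓ) (sym d≡r) (≤-trans r<M (m⊓n≤m ℓ _)) ,
    left-run-maximal (suc d + k ⊓ a′) stretch≤i0
      (left-stretch-occupied a′ d eI a-occupied backward-occupied (subst (λ x → ∀ t → t < x → at st (suc a′ + suc t) ≢ 0) (sym d≡r) forward-occupied))
    where
    d≡r : d ≡ r
    d≡r = suc-injective (+-cancelˡ-≡ (suc a′) (suc d) (suc r) (trans (+-suc (suc a′) d) (trans (sym eI) i≡)))
    stretch≤i0 : suc d + k ⊓ a′ ≤ i0
    stretch≤i0 = ≤-trans (+-monoʳ-≤ (suc d) (m⊓n≤n k a′)) (≤-reflexive (trans (cong suc (+-comm d a′)) (suc-injective (sym eI))))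

  window⇒lands : ∀ a → 1 ≤ a → i ≤ a + Fᵢ → a ≤ i + R ⊓ k → firstEmpty st (candidates k ℓ n a) ≡ just i
  window⇒lands a 1≤a lo hi with <-cmp a i
  ... | tri≈ _ refl _ = trans (firstEmpty-split i) (firstEmpty-∷-vacant st i (backward k i ++ forward ℓ n i) vacant)
  ... | tri> _ _ i<a with lt-split i<a
  ...   | d , refl = lands-from-right d (≤-trans d<B (m⊓n≤m R k)) (≤-trans d<B (m⊓n≤n R k))
    where
    d<B : suc d ≤ R ⊓ k
    d<B = +-cancelˡ-≤ i (suc d) (R ⊓ k) (subst (_≤ i + R ⊓ k) (sym (+-suc i d)) hi)
  window⇒lands (suc a′) _ lo hi | tri< a<i _ _ with lt-split a<i
  ...   | d , eI = lands-from-left a′ d eI (proj₁ budget) (proj₂ budget)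
    where
    budget : suc d ≤ ℓ × suc d + k ⊓ a′ ≤ L
    budget = ≤forwardReach⇒ k ℓ i0 L a′ d L≤i0 (sym (trans (suc-injective eI) (sym (+-suc a′ d))))
               (+-cancelˡ-≤ (suc a′) (suc d) Fᵢ (subst (_≤ suc a′ + Fᵢ) (trans eI (sym (+-suc (suc a′) d))) lo))

  lands⇒window : ∀ a → 1 ≤ a → a ≤ n → firstEmpty st (candidates k ℓ n a) ≡ just i → i ≤ a + Fᵢ × a ≤ i + R ⊓ k
  lands⇒window a 1≤a a≤n found with <-cmp a i
  ... | tri≈ _ refl _ = m≤m+n i Fᵢ , m≤m+n i (R ⊓ k)
  ... | tri> _ _ i<a with lt-split i<a
  ...   | d , refl = ≤-trans (<⇒≤ i<a) (m≤m+n _ Fᵢ) ,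
                     subst (_≤ i + R ⊓ k) (+-suc i d) (+-monoʳ-≤ i (⊓-glb (proj₁ d<) (proj₂ d<)))
    where
    d< : suc d ≤ R × suc d ≤ k
    d< = lands-from-right⇒ d a≤n found
  lands⇒window (suc a′) _ a≤n found | tri< a<i _ _ with lt-split a<i
  ...   | d , eI = subst (_≤ suc a′ + Fᵢ) (trans (+-suc (suc a′) d) (sym eI)) (+-monoʳ-≤ (suc a′) d<F) ,
                   ≤-trans (<⇒≤ a<i) (m≤m+n i (R ⊓ k))
    where
    budget : suc d ≤ ℓ × suc d + k ⊓ a′ ≤ L
    budget = lands-from-left⇒ a′ d eI found
    d<F : suc d ≤ Fᵢ
    d<F = ⇒≤forwardReach k ℓ i0 L a′ d L≤i0 (sym (trans (suc-injective eI) (sym (+-suc a′ d)))) (proj₁ budget) (proj₂ budget)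

earlier : ℕ → ℕ → Bool
earlier j v = (0 <ᵇ v) ∧ (v <ᵇ j)

module _ (π : List ℕ) (j p : ℕ) (1≤p : 1 ≤ p) (p≤ : p ≤ length π) where

  private
    at-streetBefore : at (streetBefore π j) p ≡ (if at π p <ᵇ j then at π p else 0)
    at-streetBefore = at-map (λ v → if v <ᵇ j then v else 0) π p 1≤p p≤

  streetBefore-occupied : earlier j (at π p) ≡ true → at (streetBefore π j) p ≢ 0
  streetBefore-occupied e = kept (at π p) e ∘ trans (sym at-streetBefore)
    where
    kept : ∀ v → earlier j v ≡ true → (if v <ᵇ j then v else 0) ≢ 0
    kept (suc v) e rewrite e = λ ()

  streetBefore-vacant : earlier j (at π p) ≡ false → at (streetBefore π j) p ≡ 0
  streetBefore-vacant e = trans at-streetBefore (dropped (at π p) e)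
    where
    dropped : ∀ v → earlier j v ≡ false → (if v <ᵇ j then v else 0) ≡ 0
    dropped zero    _ with 0 <ᵇ j
    ... | true  = refl
    ... | false = refl
    dropped (suc v) e rewrite e = refl

module SpotOfCar (k ℓ m n : ℕ) (π : List ℕ) (A : Arranges n (suc m) π) (t : ℕ) (t<n : t < n)
  (1≤j : 1 ≤ at π (suc t)) where

  j : ℕ
  j = at π (suc t)

  st : List ℕ
  st = streetBefore π j

  R : ℕ
  R = Right π (suc t)

  L : ℕ
  L = Left π (suc t)

  private
    inπ : ∀ {p} → p ≤ n → p ≤ length π
    inπ = subst (_ ≤_) (sym (length≡ A))

  j-vacant : at st (suc t) ≡ 0
  j-vacant = streetBefore-vacant π j (suc t) (s≤s z≤n) (inπ t<n)
               (trans (cong ((0 <ᵇ j) ∧_) (≮⇒<ᵇ≡false j j (<-irrefl refl))) (∧-zeroʳ (0 <ᵇ j)))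

  length-after : length (drop (suc t) π) ≡ n ∸ suc t
  length-after = trans (length-drop (suc t) π) (cong (_∸ suc t) (length≡ A))

  right-bound : suc t + R ≤ n
  right-bound = ≤-trans (+-monoʳ-≤ (suc t) (subst (R ≤_) length-after (length-takeWhileᵇ≤ (earlier j) (drop (suc t) π))))
                        (≤-reflexive (m+[n∸m]≡n t<n))

  right-occupied : ∀ p → suc t < p → p ≤ suc t + R → at st p ≢ 0
  right-occupied p t<p p≤ with lt-split t<p
  ... | s , refl = streetBefore-occupied π j _ (s≤s z≤n) (inπ (≤-trans p≤ right-bound))
    (subst (λ v → earlier j v ≡ true) (at-drop (suc t) π s)
      (takeWhileᵇ-all (earlier j) (drop (suc t) π) s (+-cancelˡ-< (suc t) s R p≤)))

  right-end : suc t + R < n → at st (suc (suc t + R)) ≡ 0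
  right-end t+R<n = streetBefore-vacant π j _ (s≤s z≤n) (inπ t+R<n)
    (subst (λ v → earlier j v ≡ false) (at-drop (suc t) π R)
      (takeWhileᵇ-stop (earlier j) (drop (suc t) π) (subst (R <_) (sym length-after) R<)))
    where
    R< : R < n ∸ suc t
    R< = m+n≤o⇒m≤o∸n (suc R) (subst (_≤ n) (cong suc (trans (cong suc (+-comm t R)) (sym (+-suc R t)))) t+R<n)

  length-before : length (take t π) ≡ t
  length-before = trans (length-take t π) (m≤n⇒m⊓n≡m (inπ (<⇒≤ t<n)))

  length-reversed : length (reverse (take t π)) ≡ t
  length-reversed = trans (length-reverse (take t π)) length-before

  L≤t : L ≤ t
  L≤t = subst (L ≤_) length-reversed (length-takeWhileᵇ≤ (earlier j) (reverse (take t π)))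

  at-before : ∀ s p → s + p ≡ t → 1 ≤ p → at (reverse (take t π)) (suc s) ≡ at π p
  at-before s p s+p≡t 1≤p =
    trans (at-reverse (take t π) s p (trans s+p≡t (sym length-before)) 1≤p) (at-take t π p (subst (p ≤_) s+p≡t (m≤n+m p s)))

  left-occupied : ∀ p → suc t ≤ p + L → p < suc t → at st p ≢ 0
  left-occupied zero    t<L _ = ⊥-elim (<⇒≱ t<L L≤t)
  left-occupied (suc q) t<p+L p<1+t = streetBefore-occupied π j (suc q) (s≤s z≤n) (inπ (≤-trans p≤t (<⇒≤ t<n)))
    (subst (λ v → earlier j v ≡ true) (at-before (t ∸ suc q) (suc q) (m∸n+n≡m p≤t) (s≤s z≤n))
      (takeWhileᵇ-all (earlier j) (reverse (take t π)) (t ∸ suc q) s<L))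
    where
    p≤t : suc q ≤ t
    p≤t = s≤s⁻¹ p<1+t
    s<L : t ∸ suc q < L
    s<L = +-cancelʳ-≤ (suc q) (suc (t ∸ suc q)) L
            (subst₂ _≤_ (cong suc (sym (m∸n+n≡m p≤t))) (+-comm (suc q) L) t<p+L)

  left-end : ∀ p → 1 ≤ p → p + L ≡ t → at st p ≡ 0
  left-end p 1≤p p+L≡t = streetBefore-vacant π j p 1≤p (inπ (≤-trans p≤t (<⇒≤ t<n)))
    (subst (λ v → earlier j v ≡ false) (at-before L p (trans (+-comm L p) p+L≡t) 1≤p)
      (takeWhileᵇ-stop (earlier j) (reverse (take t π)) (subst (L <_) (sym length-reversed) L<t)))
    where
    p≤t : p ≤ t
    p≤t = subst (p ≤_) p+L≡t (m≤m+n p L)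
    L<t : L < t
    L<t = subst (L <_) p+L≡t (subst (L <_) (+-comm L p) (m<m+n L 1≤p))

  open VacantSpot k ℓ n st t R L t<n j-vacant right-occupied right-end L≤t left-occupied left-end

  parksAsIn-window : ∀ a → 1 ≤ a → suc t ≤ a + Fᵢ → a ≤ suc t + R ⊓ k → parksAsIn k ℓ n π j a ≡ true
  parksAsIn-window a 1≤a lo hi rewrite window⇒lands a 1≤a lo hi = ≡ᵇ-refl j

  parksAsIn-outside : ∀ a → 1 ≤ a → a ≤ n → ¬ (suc t ≤ a + Fᵢ × a ≤ suc t + R ⊓ k) → parksAsIn k ℓ n π j a ≡ false
  parksAsIn-outside a 1≤a a≤n outside with firstEmpty st (candidates k ℓ n a) in found
  ... | nothing = refl
  ... | just u with at π u ≡ᵇ j in πu≟j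
  ...   | false = refl
  ...   | true  = ⊥-elim (outside (lands⇒window a 1≤a a≤n (trans found (cong just u≡i))))
    where
    u-range : 1 ≤ u × u ≤ length st
    u-range = vacant⇒inRange st u (firstEmpty-vacant st (candidates k ℓ n a) u found)
    j<1+m : j < suc m
    j<1+m = at-All π (suc t) (bounded A) (s≤s z≤n) (inπ t<n)
    u≡i : u ≡ suc t
    u≡i = countOcc≡1⇒position-unique π j u (suc t) (once A j 1≤j j<1+m) (≡ᵇ≡true⇒≡ _ _ πu≟j) refl
            (proj₁ u-range) (subst (u ≤_) (length-streetBefore π j) (proj₂ u-range)) (s≤s z≤n) (inπ t<n)

  parksAsIn≡inWindow : ∀ a → 1 ≤ a → a ≤ n → parksAsIn k ℓ n π j a ≡ inWindow (suc t) Fᵢ (R ⊓ k) a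
  parksAsIn≡inWindow a 1≤a a≤n with suc t ≤? a + Fᵢ | a ≤? suc t + R ⊓ k
  ... | yes lo | yes hi = trans (parksAsIn-window a 1≤a lo hi) (sym (inWindow≡true lo hi))
  ... | no ¬lo | _      = trans (parksAsIn-outside a 1≤a a≤n (¬lo ∘ proj₁)) (sym (inWindow≡false _ _ _ a (¬lo ∘ proj₁)))
  ... | yes _  | no ¬hi = trans (parksAsIn-outside a 1≤a a≤n (¬hi ∘ proj₂)) (sym (inWindow≡false _ _ _ a (¬hi ∘ proj₂)))

  choices≡B+F+1 : choices k ℓ n π j ≡ B k π (suc t) + F k ℓ π (suc t) + 1
  choices≡B+F+1 = begin
    choices k ℓ n π j
      ≡⟨ cong length (filterᵇ-cong-local _ _ (range1 n) (applyUpTo⁺₁ suc n (λ a<n → parksAsIn≡inWindow _ (s≤s z≤n) a<n))) ⟩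
    length (filterᵇ (inWindow (suc t) Fᵢ (R ⊓ k)) (range1 n))
      ≡⟨ length-window (suc t) Fᵢ (R ⊓ k) n (s≤s (≤-trans (forwardReach≤ k ℓ t L L≤t) L≤t))
                       (≤-trans (+-monoʳ-≤ (suc t) (m⊓n≤m R k)) right-bound) ⟩
    R ⊓ k + Fᵢ + 1
      ≡⟨ cong (λ x → R ⊓ k + x + 1) (F≡forwardReach k ℓ π t) ⟨
    B k π (suc t) + F k ℓ π (suc t) + 1 ∎
    where open ≡-Reasoning

factor≡oneAtZero-choices : ∀ k ℓ m n π → Arranges n (suc m) π → ∀ t → t < n →
  factor k ℓ π (suc t) ≡ oneAtZero (choices k ℓ n π) (at π (suc t))
factor≡oneAtZero-choices k ℓ m n π A t t<n = by-car (at π (suc t)) refl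
  where
  open ≡-Reasoning
  by-car : ∀ v → at π (suc t) ≡ v → factor k ℓ π (suc t) ≡ oneAtZero (choices k ℓ n π) v
  by-car zero    e = cong (λ v → if v ≡ᵇ 0 then 1 else B k π (suc t) + F k ℓ π (suc t) + 1) e
  by-car (suc c) e = begin
    factor k ℓ π (suc t)
      ≡⟨ cong (λ v → if v ≡ᵇ 0 then 1 else B k π (suc t) + F k ℓ π (suc t) + 1) e ⟩
    B k π (suc t) + F k ℓ π (suc t) + 1
      ≡⟨ SpotOfCar.choices≡B+F+1 k ℓ m n π A t t<n (subst (1 ≤_) (sym e) (s≤s z≤n)) ⟨
    choices k ℓ n π (at π (suc t))
      ≡⟨ cong (choices k ℓ n π) e ⟩
    choices k ℓ n π (suc c) ∎

length-fiber≡weight : ∀ k ℓ m n π → Arranges n (suc m) π → length (fiber k ℓ m n π) ≡ weight k ℓ n π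
length-fiber≡weight k ℓ m n π A = begin
  length (fiber k ℓ m n π)                       ≡⟨ length-fiber k ℓ m n π A ⟩
  prodFrom (choices k ℓ n π) 1 m                 ≡⟨ prodFrom-oneAtZero (choices k ℓ n π) 0 m ⟨
  prodFrom (oneAtZero (choices k ℓ n π)) 1 m     ≡⟨ product-map-Arranges _ n m π refl A ⟨
  product (map (oneAtZero (choices k ℓ n π)) π)  ≡⟨ weight≡product-map k ℓ n π _ (length≡ A) (factor≡oneAtZero-choices k ℓ m n π A) ⟨
  weight k ℓ n π                                 ∎
  where open ≡-Reasoning

theorem2p15 : (k ℓ m n : ℕ) → 1 ≤ m → m ≤ n →
    (length (PF k ℓ m n) ≡ sum (map (λ π → length (fiber k ℓ m n π)) (Smn m n)))
    × (sum (map (λ π → length (fiber k ℓ m n π)) (Smn m n))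
    ≡ sum (map (weight k ℓ n) (Smn m n)))
theorem2p15 k ℓ m n _ _ =
  PF-partition k ℓ m n ,
  cong sum (map-cong-local (All.map (λ {π} → length-fiber≡weight k ℓ m n π) (Smn-Arranges m n)))
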